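{- Let $k,n$ be integers with $n\geqslant k+2\geqslant 4$, let $a_0,\ldots,a_k$ be non-zero integers each having all of its prime factors $\leqslant k$, and let $F_{n,k}(x)=\sum_{j=0}^k a_jc_jx^j$ where $c_j=(-1)^{k-j}\binom{n}{j}\binom{n-j-1}{k-j}$. Suppose there exist a prime $p>k$ and an integer $l$ with $1\leqslant l\leqslant k-1$ such that $p\mid(n-l)$, and let $e=\mathrm{ord}_p(n-l)$; suppose further that $\gcd(e,l)\leqslant 2$ and $\gcd(e,k-l)\leqslant 2$. If $l_1<k/2$ is a positive integer such that $l\notin\{l_1,2l_1,k-l_1,k-2l_1\}$, then $F_{n,k}(x)$ has no factor of degree $l_1$ over $\mathbb{Q}$.
   Context: $\mathrm{ord}_p(m)$ denotes the exponent of the highest power of the prime $p$ dividing the non-zero integer $m$. -}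

module Defs where

open import Data.Nat as ℕ using (ℕ; zero; suc; _∸_; _<?_)
open import Data.Nat.Combinatorics using (_C_)
open import Data.Integer as ℤ using (ℤ; +_; -1ℤ)
open import Data.Rational as ℚ using (ℚ; 0ℚ)
open import Data.Fin using (Fin; fromℕ<; fromℕ)
open import Data.Vec using (Vec; lookup)
open import Data.List using (List; map; foldr; upTo)
open import Data.Product using (Σ; _×_)
open import Relation.Nullary using (yes; no; ¬_)
open import Relation.Binary.PropositionalEquality using (_≡_)

toℚ : ℤ → ℚ
toℚ z = z ℚ./ 1

c : (n k j : ℕ) → ℤ
c n k j = (-1ℤ ℤ.^ (k ∸ j)) ℤ.* ((+ (n C j)) ℤ.* (+ ((n ∸ j ∸ 1) C (k ∸ j))))

Fcoeff : (n k : ℕ) → (Fin (suc k) → ℤ) → ℕ → ℚ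
Fcoeff n k a j with j <? suc k
... | yes j<k = toℚ (a (fromℕ< j<k) ℤ.* c n k j)
... | no _ = 0ℚ

vcoeff : ∀ {m} → Vec ℚ m → ℕ → ℚ
vcoeff {m} v i with i <? m
... | yes i<m = lookup v (fromℕ< i<m)
... | no _ = 0ℚ

sumℚ : List ℚ → ℚ
sumℚ = foldr ℚ._+_ 0ℚ

conv : (ℕ → ℚ) → (ℕ → ℚ) → ℕ → ℚ
conv f g i = sumℚ (map (λ j → f j ℚ.* g (i ∸ j)) (upTo (suc i)))

-- the polynomial with coefficient function F has a factor of degree d over ℚ:
-- F = g * h with g, h ∈ ℚ[x] and deg g = d
HasFactorOfDegree : ℕ → (ℕ → ℚ) → Set
HasFactorOfDegree d F =
  Σ (Vec ℚ (suc d)) λ g → (¬ lookup g (fromℕ d) ≡ 0ℚ) ×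
  Σ ℕ λ m → Σ (Vec ℚ m) λ h → ∀ i → F i ≡ conv (vcoeff g) (vcoeff h) i

-- Since p > k, the factorials i! and (k − i)! hidden in c_i are prime to p, so
-- ord_p(c_i) + ord_p(n − i) does not depend on i; and p divides n − i only for i = l.
-- Hence the p-adic Newton polygon of F_{n,k} has exactly two edges, from (0, E) down to
-- (l, E − e) and from there up to (k, E). By Gauss's lemma for weighted valuations the
-- Newton polygon of a factor g is built from pieces of these edges, of horizontal lengths
-- s ≤ l and t ≤ k − l with s + t = deg g. Its vertices are lattice points, so l ∣ e s and
-- (k − l) ∣ e t; as gcd(e, l), gcd(e, k − l) ≤ 2, s ∈ {0, l/2, l} and t ∈ {0, (k − l)/2, k − l}.
-- For deg g = l₁ < k/2 this leaves only l ∈ {l₁, 2 l₁, k − l₁, k − 2 l₁}.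

module Submission where

open import Defs
open import Data.Nat using (ℕ; suc; _+_; _*_; _∸_; _^_; _≤_; _<_)
open import Data.Nat.Divisibility using (_∣_)
open import Data.Nat.Primality using (Prime)
open import Data.Nat.GCD using (gcd)
open import Data.Integer as ℤ using (ℤ)
open import Data.Rational using (ℚ; 0ℚ)
open import Data.Fin using (Fin)
open import Relation.Nullary using (¬_)
open import Relation.Binary.PropositionalEquality using (_≡_; _≢_)

module PadicOrder {p : ℕ} (p-prime : Prime p) where

  open import Data.Nat
  open import Data.Nat.Properties
  open import Data.Nat.Divisibility
  open import Data.Nat.Primality using (prime⇒nonZero; prime⇒nonTrivial; euclidsLemma)
  open import Data.Product using (∃; _×_; _,_; proj₁; proj₂)
  open import Data.Sum using (inj₁; inj₂)
  open import Relation.Nullary using (¬_; yes; no; contradiction)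
  open import Relation.Binary.PropositionalEquality
  open import Relation.Binary using (tri<; tri≈; tri>)
  open import Algebra.Properties.CommutativeSemigroup *-commutativeSemigroup using (interchange)
  open ≡-Reasoning

  instance
    p≢0 : NonZero p
    p≢0 = prime⇒nonZero p-prime

  1<p : 1 < p
  1<p = nonTrivial⇒n>1 p {{prime⇒nonTrivial p-prime}}

  HasOrder : ℕ → ℕ → Set
  HasOrder n a = ∃ λ u → n ≡ p ^ a * u × ¬ p ∣ u

  private
    factorOut : ∀ fuel n → n ≤ fuel → 0 < n → ∃ (HasOrder n)
    factorOut fuel n n≤fuel 0<n with p ∣? n
    ... | no p∤n = 0 , n , sym (+-identityʳ n) , p∤n
    factorOut zero n n≤0 0<n | yes _ = contradiction n≤0 (<⇒≱ 0<n)
    factorOut (suc fuel) n n≤fuel 0<n | yes (divides q n≡q*p) with factorOut fuel q q≤fuel 0<q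
      where
      0<q : 0 < q
      0<q = n≢0⇒n>0 λ q≡0 → <⇒≢ 0<n (sym (trans n≡q*p (cong (_* p) q≡0)))
      q≤fuel : q ≤ fuel
      q≤fuel = ≤-pred (≤-trans (subst (q <_) (sym n≡q*p) (m<m*n q p {{>-nonZero 0<q}} 1<p)) n≤fuel)
    ... | a , u , q≡p^a*u , p∤u = suc a , u , n≡p^[1+a]*u , p∤u
      where
      n≡p^[1+a]*u : n ≡ p * p ^ a * u
      n≡p^[1+a]*u = begin
        n               ≡⟨ n≡q*p ⟩
        q * p           ≡⟨ cong (_* p) q≡p^a*u ⟩
        p ^ a * u * p   ≡⟨ *-comm (p ^ a * u) p ⟩
        p * (p ^ a * u) ≡⟨ *-assoc p (p ^ a) u ⟨
        p * p ^ a * u   ∎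

  ord : ℕ → ℕ
  ord zero    = 0  -- junk value
  ord (suc m) = proj₁ (factorOut (suc m) (suc m) ≤-refl z<s)

  ord-spec : ∀ n .{{_ : NonZero n}} → HasOrder n (ord n)
  ord-spec (suc m) = proj₂ (factorOut (suc m) (suc m) ≤-refl z<s)

  private
    p∣p^[1+a]*u : ∀ a u → p ∣ p ^ suc a * u
    p∣p^[1+a]*u a u = divides (p ^ a * u) (trans (*-assoc p (p ^ a) u) (*-comm p (p ^ a * u)))

    order-unique : ∀ a b u w → p ^ a * u ≡ p ^ b * w → ¬ p ∣ u → ¬ p ∣ w → a ≡ b
    order-unique zero    zero    u w eq p∤u p∤w = refl
    order-unique zero    (suc b) u w eq p∤u p∤w =
      contradiction (subst (p ∣_) (trans (sym eq) (*-identityˡ u)) (p∣p^[1+a]*u b w)) p∤u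
    order-unique (suc a) zero    u w eq p∤u p∤w =
      contradiction (subst (p ∣_) (trans eq (*-identityˡ w)) (p∣p^[1+a]*u a u)) p∤w
    order-unique (suc a) (suc b) u w eq p∤u p∤w = cong suc (order-unique a b u w
      (*-cancelˡ-≡ _ _ p (trans (sym (*-assoc p (p ^ a) u)) (trans eq (*-assoc p (p ^ b) w)))) p∤u p∤w)

    p∤u⇒u≢0 : ∀ {u} → ¬ p ∣ u → NonZero u
    p∤u⇒u≢0 {zero}  p∤0 = contradiction (p ∣0) p∤0
    p∤u⇒u≢0 {suc u} _   = _

  ord[p^a*u]≡a : ∀ a u → ¬ p ∣ u → ord (p ^ a * u) ≡ a
  ord[p^a*u]≡a a u p∤u = sym (order-unique a _ u w eq p∤u p∤w)
    where
    instance
      _ = m*n≢0 (p ^ a) u {{m^n≢0 p a}} {{p∤u⇒u≢0 p∤u}}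
    w = proj₁ (ord-spec (p ^ a * u))
    eq = proj₁ (proj₂ (ord-spec (p ^ a * u)))
    p∤w = proj₂ (proj₂ (ord-spec (p ^ a * u)))

  p∤n⇒ord≡0 : ∀ {n} → ¬ p ∣ n → ord n ≡ 0
  p∤n⇒ord≡0 {n} p∤n = trans (cong ord (sym (*-identityˡ n))) (ord[p^a*u]≡a 0 n p∤n)

  ord-* : ∀ m n .{{_ : NonZero m}} .{{_ : NonZero n}} → ord (m * n) ≡ ord m + ord n
  ord-* m n with ord-spec m | ord-spec n
  ... | u , m≡p^a*u , p∤u | w , n≡p^b*w , p∤w =
    trans (cong ord m*n≡p^[a+b]*uw) (ord[p^a*u]≡a (ord m + ord n) (u * w) p∤uw)
    where
    a = ord m
    b = ord n
    m*n≡p^[a+b]*uw : m * n ≡ p ^ (a + b) * (u * w)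
    m*n≡p^[a+b]*uw = begin
      m * n                     ≡⟨ cong₂ _*_ m≡p^a*u n≡p^b*w ⟩
      (p ^ a * u) * (p ^ b * w) ≡⟨ interchange (p ^ a) u (p ^ b) w ⟩
      (p ^ a * p ^ b) * (u * w) ≡⟨ cong (_* (u * w)) (^-distribˡ-+-* p a b) ⟨
      p ^ (a + b) * (u * w)     ∎
    p∤uw : ¬ p ∣ u * w
    p∤uw p∣uw with euclidsLemma u w p-prime p∣uw
    ... | inj₁ p∣u = p∤u p∣u
    ... | inj₂ p∣w = p∤w p∣w

  p^ord∣n : ∀ n .{{_ : NonZero n}} → p ^ ord n ∣ n
  p^ord∣n n with ord-spec n
  ... | u , n≡p^a*u , _ = divides u (trans n≡p^a*u (*-comm (p ^ ord n) u))

  p^a∣p^b : ∀ {a b} → a ≤ b → p ^ a ∣ p ^ b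
  p^a∣p^b {a} {b} a≤b = divides (p ^ (b ∸ a))
    (trans (cong (p ^_) (sym (m∸n+n≡m a≤b))) (^-distribˡ-+-* p (b ∸ a) a))

  p^t∣n⇒t≤ord : ∀ {t} n .{{_ : NonZero n}} → p ^ t ∣ n → t ≤ ord n
  p^t∣n⇒t≤ord {t} n p^t∣n with t ≤? ord n | ord-spec n
  ... | yes t≤a | _ = t≤a
  ... | no t≰a | u , n≡p^a*u , p∤u = contradiction p∣u p∤u
    where
    a = ord n
    r = t ∸ suc a
    t≡a+[1+r] : t ≡ a + suc r
    t≡a+[1+r] = trans (sym (m+[n∸m]≡n (≰⇒> t≰a))) (sym (+-suc a r))
    p^a*p^[1+r]∣p^a*u : p ^ a * p ^ suc r ∣ p ^ a * u
    p^a*p^[1+r]∣p^a*u =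
      subst₂ _∣_ (trans (cong (p ^_) t≡a+[1+r]) (^-distribˡ-+-* p a (suc r))) n≡p^a*u p^t∣n
    p∣u : p ∣ u
    p∣u = ∣-trans (divides (p ^ r) (*-comm p (p ^ r))) (*-cancelˡ-∣ (p ^ a) {{m^n≢0 p a}} p^a*p^[1+r]∣p^a*u)

  ord-exact : ∀ {e} n .{{_ : NonZero n}} → p ^ e ∣ n → ¬ p ^ suc e ∣ n → ord n ≡ e
  ord-exact n p^e∣n p^[1+e]∤n = ≤-antisym
    (≮⇒≥ λ e<ord → p^[1+e]∤n (∣-trans (p^a∣p^b e<ord) (p^ord∣n n)))
    (p^t∣n⇒t≤ord n p^e∣n)

  p∤m! : ∀ {m} → m < p → ¬ p ∣ m !
  p∤m! {zero}  _   p∣1 = <⇒≱ 1<p (∣⇒≤ p∣1)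
  p∤m! {suc m} m<p p∣m! with euclidsLemma (suc m) (m !) p-prime p∣m!
  ... | inj₁ p∣1+m = <⇒≱ m<p (∣⇒≤ p∣1+m)
  ... | inj₂ p∣m!  = p∤m! (<-trans (n<1+n m) m<p) p∣m!

  private
    p∣n∸x⇒p∤n∸y : ∀ {n x y} → x < y → y < p → y ≤ n → p ∣ n ∸ x → ¬ p ∣ n ∸ y
    p∣n∸x⇒p∤n∸y {n} {x} {y} x<y y<p y≤n p∣n∸x p∣n∸y = <⇒≱ (≤-<-trans (m∸n≤m y x) y<p)
      (∣⇒≤ {{>-nonZero (m<n⇒0<n∸m x<y)}} (∣m+n∣m⇒∣n (subst (p ∣_) n∸x≡[n∸y]+[y∸x] p∣n∸x) p∣n∸y))
      where
      n∸x≡[n∸y]+[y∸x] : n ∸ x ≡ (n ∸ y) + (y ∸ x)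
      n∸x≡[n∸y]+[y∸x] = trans (cong (_∸ x) (sym (m∸n+n≡m y≤n))) (+-∸-assoc (n ∸ y) (<⇒≤ x<y))

  p∣n∸l⇒p∤n∸i : ∀ {n i l} → i ≤ n → l ≤ n → i ≢ l → i < p → l < p → p ∣ n ∸ l → ¬ p ∣ n ∸ i
  p∣n∸l⇒p∤n∸i {n} {i} {l} i≤n l≤n i≢l i<p l<p p∣n∸l p∣n∸i with <-cmp i l
  ... | tri< i<l _ _ = p∣n∸x⇒p∤n∸y i<l l<p l≤n p∣n∸i p∣n∸l
  ... | tri≈ _ i≡l _ = i≢l i≡l
  ... | tri> _ _ l<i = p∣n∸x⇒p∤n∸y l<i i<p i≤n p∣n∸l p∣n∸i

module Valuation {p : ℕ} (p-prime : Prime p) where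

  open import Data.Nat as ℕ using (NonZero; _^_)
  import Data.Nat.Properties as ℕ
  import Data.Nat.Divisibility as ℕ
  open import Data.Integer as ℤ using (ℤ; +_; ∣_∣; 0ℤ; _⊖_)
  import Data.Integer.Properties as ℤ
  open import Data.Integer.Divisibility.Signed as ℤ using (∣ᵤ⇒∣; ∣⇒∣ᵤ)
  open import Data.Integer.Tactic.RingSolver using (solve-∀)
  open import Data.Rational as ℚ using (ℚ; 0ℚ; ↥_; ↧_; ↧ₙ_)
  import Data.Rational.Properties as ℚ
  import Data.Rational.Unnormalised as ℚᵘ
  open import Data.Product using (_×_; _,_; proj₁; proj₂)
  open import Data.Sum using (_⊎_; inj₁; inj₂)
  open import Relation.Nullary using (¬_)
  open import Relation.Binary.PropositionalEquality
  open import Defs using (toℚ)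
  open PadicOrder p-prime public

  ordℤ : ℤ → ℕ
  ordℤ z = ord ∣ z ∣

  v : ℚ → ℤ
  v q = ordℤ (↥ q) ⊖ ord (↧ₙ q)

  private
    ∣z∣≢0 : ∀ {z} → z ≢ 0ℤ → NonZero ∣ z ∣
    ∣z∣≢0 z≢0 = ℕ.≢-nonZero (λ ∣z∣≡0 → z≢0 (ℤ.∣i∣≡0⇒i≡0 ∣z∣≡0))

    ↥≢0 : ∀ {q} → q ≢ 0ℚ → ↥ q ≢ 0ℤ
    ↥≢0 {q} q≢0 ↥q≡0 = q≢0 (ℚ.↥p≡0⇒p≡0 q ↥q≡0)

    +≢0 : ∀ d .{{_ : NonZero d}} → + d ≢ 0ℤ
    +≢0 (ℕ.suc d) ()

    ↧≢0 : ∀ q → + ↧ₙ q ≢ 0ℤ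
    ↧≢0 q ()

    ⊖-swap : ∀ a b c d → a ℕ.+ b ≡ c ℕ.+ d → a ⊖ d ≡ c ⊖ b
    ⊖-swap a b c d eq = begin
      a ⊖ d                 ≡⟨ ℤ.+-cancelˡ-⊖ b a d ⟨
      (b ℕ.+ a) ⊖ (b ℕ.+ d) ≡⟨ cong₂ _⊖_ (trans (ℕ.+-comm b a) eq) (ℕ.+-comm b d) ⟩
      (c ℕ.+ d) ⊖ (d ℕ.+ b) ≡⟨ cong (_⊖ (d ℕ.+ b)) (ℕ.+-comm c d) ⟩
      (d ℕ.+ c) ⊖ (d ℕ.+ b) ≡⟨ ℤ.+-cancelˡ-⊖ d c b ⟩
      c ⊖ b                 ∎
      where open ≡-Reasoning

    ⊖-cancelʳ : ∀ a b c → (a ℕ.+ b) ⊖ (c ℕ.+ b) ≡ a ⊖ c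
    ⊖-cancelʳ a b c = trans (cong₂ _⊖_ (ℕ.+-comm a b) (ℕ.+-comm c b)) (ℤ.+-cancelˡ-⊖ b a c)

    ⊖-+ : ∀ a b c d → (a ℕ.+ b) ⊖ (c ℕ.+ d) ≡ (a ⊖ c) ℤ.+ (b ⊖ d)
    ⊖-+ a b c d = begin
      (a ℕ.+ b) ⊖ (c ℕ.+ d)           ≡⟨ ℤ.m-n≡m⊖n (a ℕ.+ b) (c ℕ.+ d) ⟨
      + (a ℕ.+ b) ℤ.- + (c ℕ.+ d)     ≡⟨ cong₂ ℤ._-_ (ℤ.pos-+ a b) (ℤ.pos-+ c d) ⟩
      (+ a ℤ.+ + b) ℤ.- (+ c ℤ.+ + d) ≡⟨ regroup (+ a) (+ b) (+ c) (+ d) ⟩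
      (+ a ℤ.- + c) ℤ.+ (+ b ℤ.- + d) ≡⟨ cong₂ ℤ._+_ (ℤ.m-n≡m⊖n a c) (ℤ.m-n≡m⊖n b d) ⟩
      (a ⊖ c) ℤ.+ (b ⊖ d)             ∎
      where
      open ≡-Reasoning
      regroup : ∀ a b c d → (a ℤ.+ b) ℤ.- (c ℤ.+ d) ≡ (a ℤ.- c) ℤ.+ (b ℤ.- d)
      regroup = solve-∀

  i≢0∧j≢0⇒i*j≢0 : ∀ {a b} → a ≢ 0ℤ → b ≢ 0ℤ → a ℤ.* b ≢ 0ℤ
  i≢0∧j≢0⇒i*j≢0 {a} a≢0 b≢0 ab≡0 with ℤ.i*j≡0⇒i≡0∨j≡0 a ab≡0
  ... | inj₁ a≡0 = a≢0 a≡0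
  ... | inj₂ b≡0 = b≢0 b≡0

  ordℤ-* : ∀ {a b} → a ≢ 0ℤ → b ≢ 0ℤ → ordℤ (a ℤ.* b) ≡ ordℤ a ℕ.+ ordℤ b
  ordℤ-* {a} {b} a≢0 b≢0 =
    trans (cong ord (ℤ.abs-* a b)) (ord-* ∣ a ∣ ∣ b ∣ {{∣z∣≢0 a≢0}} {{∣z∣≢0 b≢0}})

  v-fraction : ∀ q n d .{{_ : NonZero d}} → n ≢ 0ℤ → ↥ q ℤ.* + d ≡ n ℤ.* ↧ q →
               q ≢ 0ℚ × v q ≡ ordℤ n ⊖ ord d
  v-fraction q n d n≢0 cross = q≢0 , ⊖-swap _ (ord d) (ordℤ n) _ ord-cross
    where
    ↥q≢0 : ↥ q ≢ 0ℤ
    ↥q≢0 ↥q≡0 = i≢0∧j≢0⇒i*j≢0 n≢0 (↧≢0 q)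
      (trans (sym cross) (trans (cong (ℤ._* + d) ↥q≡0) (ℤ.*-zeroˡ (+ d))))
    q≢0 : q ≢ 0ℚ
    q≢0 q≡0 = ↥q≢0 (ℚ.p≡0⇒↥p≡0 q q≡0)
    ord-cross : ordℤ (↥ q) ℕ.+ ord d ≡ ordℤ n ℕ.+ ord (↧ₙ q)
    ord-cross = trans (sym (ordℤ-* ↥q≢0 (+≢0 d))) (trans (cong ordℤ cross) (ordℤ-* n≢0 (↧≢0 q)))

  *-fraction : ∀ x y → ↥ (x ℚ.* y) ℤ.* + (↧ₙ x ℕ.* ↧ₙ y) ≡ (↥ x ℤ.* ↥ y) ℤ.* ↧ (x ℚ.* y)
  *-fraction x@record{} y@record{} with ℚ.toℚᵘ-homo-* x y
  ... | ℚᵘ.*≡* eq = trans (cong (ℤ._* + (↧ₙ x ℕ.* ↧ₙ y)) (sym (ℚ.↥ᵘ-toℚᵘ (x ℚ.* y))))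
                          (trans eq (cong ((↥ x ℤ.* ↥ y) ℤ.*_) (ℚ.↧ᵘ-toℚᵘ (x ℚ.* y))))

  +-fraction : ∀ x y →
               ↥ (x ℚ.+ y) ℤ.* + (↧ₙ x ℕ.* ↧ₙ y) ≡ (↥ x ℤ.* ↧ y ℤ.+ ↥ y ℤ.* ↧ x) ℤ.* ↧ (x ℚ.+ y)
  +-fraction x@record{} y@record{} with ℚ.toℚᵘ-homo-+ x y
  ... | ℚᵘ.*≡* eq = trans (cong (ℤ._* + (↧ₙ x ℕ.* ↧ₙ y)) (sym (ℚ.↥ᵘ-toℚᵘ (x ℚ.+ y))))
                          (trans eq (cong ((↥ x ℤ.* ↧ y ℤ.+ ↥ y ℤ.* ↧ x) ℤ.*_) (ℚ.↧ᵘ-toℚᵘ (x ℚ.+ y))))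

  v-toℚ : ∀ z → z ≢ 0ℤ → toℚ z ≢ 0ℚ × v (toℚ z) ≡ + ordℤ z
  v-toℚ z z≢0 with ℚ.toℚᵘ-fromℚᵘ (ℚᵘ.mkℚᵘ z 0)
  ... | ℚᵘ.*≡* eq = proj₁ frac , trans (proj₂ frac) (cong (ordℤ z ⊖_) ord1≡0)
    where
    cross : ↥ toℚ z ℤ.* + 1 ≡ z ℤ.* ↧ toℚ z
    cross = trans (cong (ℤ._* + 1) (sym (ℚ.↥ᵘ-toℚᵘ (toℚ z))))
                  (trans eq (cong (z ℤ.*_) (ℚ.↧ᵘ-toℚᵘ (toℚ z))))
    frac = v-fraction (toℚ z) z 1 z≢0 cross
    ord1≡0 : ord 1 ≡ 0
    ord1≡0 = p∤n⇒ord≡0 λ p∣1 → ℕ.<⇒≱ 1<p (ℕ.∣⇒≤ p∣1)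

  v-* : ∀ {x y} → x ≢ 0ℚ → y ≢ 0ℚ → x ℚ.* y ≢ 0ℚ × v (x ℚ.* y) ≡ v x ℤ.+ v y
  v-* {x} {y} x≢0 y≢0 with v-fraction (x ℚ.* y) (↥ x ℤ.* ↥ y) (↧ₙ x ℕ.* ↧ₙ y)
                             (i≢0∧j≢0⇒i*j≢0 (↥≢0 x≢0) (↥≢0 y≢0)) (*-fraction x y)
  ... | xy≢0 , v[xy] = xy≢0 , (begin
    v (x ℚ.* y)
      ≡⟨ v[xy] ⟩
    ordℤ (↥ x ℤ.* ↥ y) ⊖ ord (↧ₙ x ℕ.* ↧ₙ y)
      ≡⟨ cong₂ _⊖_ (ordℤ-* (↥≢0 x≢0) (↥≢0 y≢0)) (ord-* (↧ₙ x) (↧ₙ y)) ⟩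
    (ordℤ (↥ x) ℕ.+ ordℤ (↥ y)) ⊖ (ord (↧ₙ x) ℕ.+ ord (↧ₙ y))
      ≡⟨ ⊖-+ (ordℤ (↥ x)) (ordℤ (↥ y)) (ord (↧ₙ x)) (ord (↧ₙ y)) ⟩
    v x ℤ.+ v y ∎)
    where open ≡-Reasoning

  private
    t≤ordℤ⇒p^t∣z : ∀ {t} z → z ≢ 0ℤ → t ℕ.≤ ordℤ z → + (p ^ t) ℤ.∣ z
    t≤ordℤ⇒p^t∣z z z≢0 t≤ordℤz = ∣ᵤ⇒∣ (ℕ.∣-trans (p^a∣p^b t≤ordℤz) (p^ord∣n ∣ z ∣ {{∣z∣≢0 z≢0}}))

    p^t∣z⇒t≤ordℤ : ∀ {t} z → z ≢ 0ℤ → + (p ^ t) ℤ.∣ z → t ℕ.≤ ordℤ z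
    p^t∣z⇒t≤ordℤ z z≢0 p^t∣z = p^t∣n⇒t≤ord ∣ z ∣ {{∣z∣≢0 z≢0}} (∣⇒∣ᵤ p^t∣z)

  ordℤ-+-≥ : ∀ {t a b} → a ≢ 0ℤ → b ≢ 0ℤ → a ℤ.+ b ≢ 0ℤ →
             t ℕ.≤ ordℤ a → t ℕ.≤ ordℤ b → t ℕ.≤ ordℤ (a ℤ.+ b)
  ordℤ-+-≥ {a = a} {b} a≢0 b≢0 a+b≢0 t≤a t≤b = p^t∣z⇒t≤ordℤ (a ℤ.+ b) a+b≢0
    (ℤ.∣m∣n⇒∣m+n (t≤ordℤ⇒p^t∣z a a≢0 t≤a) (t≤ordℤ⇒p^t∣z b b≢0 t≤b))

  ordℤ-+-< : ∀ {a b} → a ≢ 0ℤ → b ≢ 0ℤ → ordℤ a ℕ.< ordℤ b →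
             a ℤ.+ b ≢ 0ℤ × ordℤ (a ℤ.+ b) ≡ ordℤ a
  ordℤ-+-< {a} {b} a≢0 b≢0 a<b = a+b≢0 , ℕ.≤-antisym
    (ℕ.≮⇒≥ λ a<a+b → p^[1+t]∤a+b (t≤ordℤ⇒p^t∣z (a ℤ.+ b) a+b≢0 a<a+b))
    (ordℤ-+-≥ a≢0 b≢0 a+b≢0 ℕ.≤-refl (ℕ.<⇒≤ a<b))
    where
    p^[1+t]∤a+b : ¬ + (p ^ ℕ.suc (ordℤ a)) ℤ.∣ a ℤ.+ b
    p^[1+t]∤a+b p^[1+t]∣a+b = ℕ.<-irrefl refl (p^t∣z⇒t≤ordℤ a a≢0
      (ℤ.∣m+n∣n⇒∣m p^[1+t]∣a+b (t≤ordℤ⇒p^t∣z b b≢0 a<b)))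
    a+b≢0 : a ℤ.+ b ≢ 0ℤ
    a+b≢0 a+b≡0 = p^[1+t]∤a+b (subst (_ ℤ.∣_) (sym a+b≡0) (ℤ.divides 0ℤ refl))

  private
    module SumFraction {x y : ℚ} (x≢0 : x ≢ 0ℚ) (y≢0 : y ≢ 0ℚ) where
      a b : ℤ
      a = ↥ x ℤ.* ↧ y
      b = ↥ y ℤ.* ↧ x
      D : ℕ
      D = ↧ₙ x ℕ.* ↧ₙ y

      a≢0 : a ≢ 0ℤ
      a≢0 = i≢0∧j≢0⇒i*j≢0 (↥≢0 x≢0) (↧≢0 y)
      b≢0 : b ≢ 0ℤ
      b≢0 = i≢0∧j≢0⇒i*j≢0 (↥≢0 y≢0) (↧≢0 x)

      v[x] : v x ≡ ordℤ a ⊖ ord D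
      v[x] = sym (trans (cong₂ _⊖_ (ordℤ-* (↥≢0 x≢0) (↧≢0 y)) (ord-* (↧ₙ x) (↧ₙ y)))
                        (⊖-cancelʳ (ordℤ (↥ x)) (ord (↧ₙ y)) (ord (↧ₙ x))))
      v[y] : v y ≡ ordℤ b ⊖ ord D
      v[y] = sym (trans (cong₂ _⊖_ (ordℤ-* (↥≢0 y≢0) (↧≢0 x))
                                   (trans (ord-* (↧ₙ x) (↧ₙ y)) (ℕ.+-comm (ord (↧ₙ x)) (ord (↧ₙ y)))))
                        (⊖-cancelʳ (ordℤ (↥ y)) (ord (↧ₙ x)) (ord (↧ₙ y))))

      v[x+y] : a ℤ.+ b ≢ 0ℤ → x ℚ.+ y ≢ 0ℚ × v (x ℚ.+ y) ≡ ordℤ (a ℤ.+ b) ⊖ ord D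
      v[x+y] a+b≢0 = v-fraction (x ℚ.+ y) (a ℤ.+ b) D a+b≢0 (+-fraction x y)

      x+y≢0⇒a+b≢0 : x ℚ.+ y ≢ 0ℚ → a ℤ.+ b ≢ 0ℤ
      x+y≢0⇒a+b≢0 x+y≢0 a+b≡0 = x+y≢0 (ℚ.↥p≡0⇒p≡0 (x ℚ.+ y) ↥[x+y]≡0)
        where
        ↥[x+y]≡0 : ↥ (x ℚ.+ y) ≡ 0ℤ
        ↥[x+y]≡0 with ℤ.i*j≡0⇒i≡0∨j≡0 (↥ (x ℚ.+ y))
                        (trans (+-fraction x y) (cong (ℤ._* ↧ (x ℚ.+ y)) a+b≡0))
        ... | inj₁ ↥≡0 = ↥≡0
        ... | inj₂ ()

      ≤-from-ordℤ : ∀ u {w} → ordℤ u ℕ.≤ ordℤ (a ℤ.+ b) → a ℤ.+ b ≢ 0ℤ → w ≡ ordℤ u ⊖ ord D →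
                    w ℤ.≤ v (x ℚ.+ y)
      ≤-from-ordℤ u u≤a+b a+b≢0 refl =
        subst (ordℤ u ⊖ ord D ℤ.≤_) (sym (proj₂ (v[x+y] a+b≢0))) (ℤ.⊖-monoˡ-≤ (ord D) u≤a+b)

      ≥-min : x ℚ.+ y ≢ 0ℚ → v x ℤ.≤ v (x ℚ.+ y) ⊎ v y ℤ.≤ v (x ℚ.+ y)
      ≥-min x+y≢0 with ℕ.≤-total (ordℤ a) (ordℤ b)
      ... | inj₁ a≤b = inj₁ (≤-from-ordℤ a (ordℤ-+-≥ a≢0 b≢0 a+b≢0 ℕ.≤-refl a≤b) a+b≢0 v[x])
        where a+b≢0 = x+y≢0⇒a+b≢0 x+y≢0
      ... | inj₂ b≤a = inj₂ (≤-from-ordℤ b (ordℤ-+-≥ a≢0 b≢0 a+b≢0 b≤a ℕ.≤-refl) a+b≢0 v[y])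
        where a+b≢0 = x+y≢0⇒a+b≢0 x+y≢0

      ≡-smaller : v x ℤ.< v y → x ℚ.+ y ≢ 0ℚ × v (x ℚ.+ y) ≡ v x
      ≡-smaller vx<vy = proj₁ v[x+y]′ , trans (proj₂ v[x+y]′) (trans (cong (_⊖ ord D) (proj₂ sum)) (sym v[x]))
        where
        a<b : ordℤ a ℕ.< ordℤ b
        a<b = ℕ.≰⇒> λ b≤a → ℤ.<⇒≱ vx<vy (subst₂ ℤ._≤_ (sym v[y]) (sym v[x]) (ℤ.⊖-monoˡ-≤ (ord D) b≤a))
        sum = ordℤ-+-< a≢0 b≢0 a<b
        v[x+y]′ = v[x+y] (proj₁ sum)

  v-+-≥ : ∀ {x y} → x ≢ 0ℚ → y ≢ 0ℚ → x ℚ.+ y ≢ 0ℚ → v x ℤ.≤ v (x ℚ.+ y) ⊎ v y ℤ.≤ v (x ℚ.+ y)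
  v-+-≥ x≢0 y≢0 = SumFraction.≥-min x≢0 y≢0

  v-+-< : ∀ {x y} → x ≢ 0ℚ → y ≢ 0ℚ → v x ℤ.< v y → x ℚ.+ y ≢ 0ℚ × v (x ℚ.+ y) ≡ v x
  v-+-< x≢0 y≢0 = SumFraction.≡-smaller x≢0 y≢0

module RationalSums where

  open import Data.Nat using (suc; _<_; _∸_; s<s; z<s)
  open import Data.Nat.Properties using (suc-injective)
  open import Data.Rational as ℚ using (ℚ; 0ℚ)
  open import Data.List using (applyUpTo)
  open import Data.List.Properties using (map-upTo; foldr-preservesᵇ)
  open import Data.List.Relation.Unary.All.Properties using (applyUpTo⁺₁)
  open import Function using (_∘_)
  open import Relation.Binary.PropositionalEquality using (_≡_; _≢_; cong)
  open import Defs using (sumℚ; conv)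

  sumUpTo : (ℕ → ℚ) → ℕ → ℚ
  sumUpTo ψ n = sumℚ (applyUpTo ψ n)

  conv≡sumUpTo : ∀ f g i → conv f g i ≡ sumUpTo (λ j → f j ℚ.* g (i ∸ j)) (suc i)
  conv≡sumUpTo f g i = cong sumℚ (map-upTo (λ j → f j ℚ.* g (i ∸ j)) (suc i))

  module _ {P : ℚ → Set} (P0 : P 0ℚ) (P+ : ∀ {a b} → P a → P b → P (a ℚ.+ b)) where

    sumUpTo-preserves : ∀ ψ n → (∀ {j} → j < n → P (ψ j)) → P (sumUpTo ψ n)
    sumUpTo-preserves ψ n Pψ = foldr-preservesᵇ {P = P} P+ P0 (applyUpTo⁺₁ ψ n Pψ)

    sumUpTo-dominated : ∀ {Q : ℚ → Set} →
                        (∀ {a b} → Q a → P b → Q (a ℚ.+ b)) → (∀ {a b} → P a → Q b → Q (a ℚ.+ b)) →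
                        ∀ ψ n {j₀} → j₀ < n → Q (ψ j₀) → (∀ {j} → j < n → j ≢ j₀ → P (ψ j)) →
                        Q (sumUpTo ψ n)
    sumUpTo-dominated Q+P P+Q ψ (suc n) {0} _ Qψ₀ Pψ =
      Q+P {ψ 0} Qψ₀ (sumUpTo-preserves (ψ ∘ suc) n λ j<n → Pψ (s<s j<n) λ ())
    sumUpTo-dominated {Q} Q+P P+Q ψ (suc n) {suc j₀} (s<s j₀<n) Qψ₀ Pψ =
      P+Q {ψ 0} (Pψ z<s λ ()) (sumUpTo-dominated {Q} Q+P P+Q (ψ ∘ suc) n j₀<n Qψ₀
                           λ j<n j≢j₀ → Pψ (s<s j<n) (j≢j₀ ∘ suc-injective))

module BoundedSearch where

  open import Data.Nat using (zero; suc; _<_; _≤_; z≤n; s≤s; s<s)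
  open import Data.Nat.Properties using (≤-refl; ≤-pred; m≤n⇒m<n∨m≡n; m≤n⇒m≤1+n; <-irrefl; ≤-trans)
  open import Data.Integer as ℤ using (ℤ)
  import Data.Integer.Properties as ℤ
  open import Data.Product using (∃; _×_; _,_)
  open import Data.Sum using (_⊎_; inj₁; inj₂)
  open import Relation.Nullary using (¬_; yes; no; contradiction)
  open import Relation.Unary using (Decidable)
  open import Relation.Binary.PropositionalEquality using (refl)

  <-suc-cases : ∀ {R : ℕ → Set} {N} → (∀ {i} → i < N → R i) → R N → ∀ {i} → i < suc N → R i
  <-suc-cases R<N RN i<1+N with m≤n⇒m<n∨m≡n (≤-pred i<1+N)
  ... | inj₁ i<N = R<N i<N
  ... | inj₂ refl = RN

  least-witness : ∀ {Q : ℕ → Set} → Decidable Q → ∀ {j} → Q j →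
                  ∃ λ i → Q i × i ≤ j × (∀ {i′} → i′ < i → ¬ Q i′)
  least-witness Q? {zero} Qj = 0 , Qj , z≤n , λ ()
  least-witness Q? {suc j} Qj with Q? 0
  ... | yes Q0 = 0 , Q0 , z≤n , λ ()
  ... | no ¬Q0 with least-witness (λ i → Q? (suc i)) Qj
  ...   | i , Qi , i≤j , least = suc i , Qi , s≤s i≤j , λ { {zero} _ → ¬Q0 ; {suc _} (s<s i′<i) → least i′<i }

  greatest-witness-below : ∀ {Q : ℕ → Set} → Decidable Q → ∀ N {j} → j < N → Q j →
                           ∃ λ i → Q i × i < N × j ≤ i × (∀ {i′} → i < i′ → i′ < N → ¬ Q i′)
  greatest-witness-below {Q} Q? (suc N) {j} j<1+N Qj with Q? N
  ... | yes QN = N , QN , ≤-refl , ≤-pred j<1+N , λ N<i′ i′<1+N _ → <-irrefl refl (≤-trans N<i′ (≤-pred i′<1+N))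
  ... | no ¬QN with m≤n⇒m<n∨m≡n (≤-pred j<1+N)
  ...   | inj₂ refl = contradiction Qj ¬QN
  ...   | inj₁ j<N with greatest-witness-below Q? N j<N Qj
  ...     | i , Qi , i<N , j≤i , greatest =
              i , Qi , m≤n⇒m≤1+n i<N , j≤i , λ i<i′ i′<1+N → <-suc-cases {R = λ i′ → i < i′ → ¬ Q i′}
                                                             (λ i′<N i<i′ → greatest i<i′ i′<N) (λ _ → ¬QN) i′<1+N i<i′

  record MinimumBelow (P : ℕ → Set) (w : ℕ → ℤ) (N : ℕ) : Set where
    field
      arg     : ℕ
      P-arg   : P arg
      minimal : ∀ {i} → i < N → P i → w arg ℤ.≤ w i

  minimum-below : ∀ {P : ℕ → Set} → Decidable P → (w : ℕ → ℤ) → ∀ N →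
                  (∀ {i} → i < N → ¬ P i) ⊎ MinimumBelow P w N
  minimum-below P? w zero = inj₁ λ ()
  minimum-below {P} P? w (suc N) with minimum-below P? w N | P? N
  ... | inj₁ none | no ¬PN = inj₁ (<-suc-cases {R = λ i → ¬ P i} none ¬PN)
  ... | inj₁ none | yes PN =
    inj₂ (record { arg = N ; P-arg = PN
                 ; minimal = <-suc-cases {R = λ i → P i → w N ℤ.≤ w i}
                                         (λ i<N Pi → contradiction Pi (none i<N)) (λ _ → ℤ.≤-refl) })
  ... | inj₂ m | no ¬PN =
    inj₂ (record { arg = arg ; P-arg = P-arg
                 ; minimal = <-suc-cases minimal (λ PN → contradiction PN ¬PN) })
    where open MinimumBelow m
  ... | inj₂ m | yes PN with ℤ.≤-total (w (MinimumBelow.arg m)) (w N)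
  ...   | inj₁ m≤N = inj₂ (record { arg = arg ; P-arg = P-arg
                                  ; minimal = <-suc-cases minimal (λ _ → m≤N) })
    where open MinimumBelow m
  ...   | inj₂ N≤m = inj₂ (record { arg = N ; P-arg = PN
                                  ; minimal = <-suc-cases {R = λ i → P i → w N ℤ.≤ w i}
                                                          (λ i<N Pi → ℤ.≤-trans N≤m (minimal i<N Pi))
                                                          (λ _ → ℤ.≤-refl) })
    where open MinimumBelow m

module NewtonFace {p : ℕ} (p-prime : Prime p) (λ′ : ℕ) (μ : ℤ) where

  open import Data.Nat as ℕ using (suc; _∸_; _<_; _≤_; s<s)
  import Data.Nat.Divisibility as ℕ
  import Data.Nat.Properties as ℕ
  open import Data.Integer as ℤ using (+_; 0ℤ)
  import Data.Integer.Properties as ℤ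
  open import Data.Integer.Tactic.RingSolver using (solve-∀)
  open import Data.Rational as ℚ using (ℚ; 0ℚ; _≟_)
  import Data.Rational.Properties as ℚ
  open import Data.Product using (_×_; _,_; proj₁; proj₂)
  open import Data.Sum using (_⊎_; inj₁; inj₂)
  open import Relation.Nullary using (Dec; yes; no; contradiction; ¬?; _×-dec_)
  open import Relation.Binary using (tri<; tri≈; tri>)
  open import Relation.Binary.PropositionalEquality
  open import Defs using (conv)
  open Valuation p-prime
  open RationalSums
  open BoundedSearch

  weight : (ℕ → ℚ) → ℕ → ℤ
  weight f j = + λ′ ℤ.* v (f j) ℤ.+ μ ℤ.* + j

  -- The edge of slope −μ/λ′ of the Newton polygon of f: min is the least weight over the
  -- support of f, and first and last are the extreme indices attaining it.
  record Face (f : ℕ → ℚ) : Set where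
    field
      min          : ℤ
      first last   : ℕ
      first≢0      : f first ≢ 0ℚ
      weight-first : weight f first ≡ min
      last≢0       : f last ≢ 0ℚ
      weight-last  : weight f last ≡ min
      min≤weight   : ∀ {j} → f j ≢ 0ℚ → min ℤ.≤ weight f j
      before-first : ∀ {j} → j < first → f j ≢ 0ℚ → min ℤ.< weight f j
      after-last   : ∀ {j} → last < j → f j ≢ 0ℚ → min ℤ.< weight f j

  first≤last : ∀ {f} (Φ : Face f) → Face.first Φ ≤ Face.last Φ
  first≤last Φ = ℕ.≮⇒≥ λ last<first →
    ℤ.<-irrefl (sym weight-last) (before-first last<first last≢0)
    where open Face Φ

  equal-weights⇒λ∣∣μ∣*[j∸i] : ∀ {f i j} → i ≤ j → weight f i ≡ weight f j → λ′ ℕ.∣ ℤ.∣ μ ∣ ℕ.* (j ∸ i)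
  equal-weights⇒λ∣∣μ∣*[j∸i] {f} {i} {j} i≤j wi≡wj = ℕ.divides ℤ.∣ v (f i) ℤ.- v (f j) ∣ (begin
    ℤ.∣ μ ∣ ℕ.* (j ∸ i)                  ≡⟨ ℤ.abs-* μ (+ (j ∸ i)) ⟨
    ℤ.∣ μ ℤ.* + (j ∸ i) ∣                ≡⟨ cong ℤ.∣_∣ μ[j∸i]≡λ[vi-vj] ⟩
    ℤ.∣ + λ′ ℤ.* (v (f i) ℤ.- v (f j)) ∣ ≡⟨ ℤ.abs-* (+ λ′) (v (f i) ℤ.- v (f j)) ⟩
    λ′ ℕ.* ℤ.∣ v (f i) ℤ.- v (f j) ∣     ≡⟨ ℕ.*-comm λ′ _ ⟩
    ℤ.∣ v (f i) ℤ.- v (f j) ∣ ℕ.* λ′     ∎)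
    where
    open ≡-Reasoning
    +[j∸i] : + (j ∸ i) ≡ + j ℤ.- + i
    +[j∸i] = trans (sym (ℤ.⊖-≥ i≤j)) (sym (ℤ.m-n≡m⊖n j i))
    rearrange : ∀ L a b m I J →
                L ℤ.* (a ℤ.- b) ≡ m ℤ.* (J ℤ.- I) ℤ.+ ((L ℤ.* a ℤ.+ m ℤ.* I) ℤ.- (L ℤ.* b ℤ.+ m ℤ.* J))
    rearrange = solve-∀
    μ[j∸i]≡λ[vi-vj] : μ ℤ.* + (j ∸ i) ≡ + λ′ ℤ.* (v (f i) ℤ.- v (f j))
    μ[j∸i]≡λ[vi-vj] = sym (begin
      + λ′ ℤ.* (v (f i) ℤ.- v (f j))
        ≡⟨ rearrange (+ λ′) (v (f i)) (v (f j)) μ (+ i) (+ j) ⟩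
      μ ℤ.* (+ j ℤ.- + i) ℤ.+ (weight f i ℤ.- weight f j)
        ≡⟨ cong (λ w → μ ℤ.* (+ j ℤ.- + i) ℤ.+ (w ℤ.- weight f j)) wi≡wj ⟩
      μ ℤ.* (+ j ℤ.- + i) ℤ.+ (weight f j ℤ.- weight f j)
        ≡⟨ cong (λ z → μ ℤ.* (+ j ℤ.- + i) ℤ.+ z) (ℤ.+-inverseʳ (weight f j)) ⟩
      μ ℤ.* (+ j ℤ.- + i) ℤ.+ 0ℤ
        ≡⟨ ℤ.+-identityʳ _ ⟩
      μ ℤ.* (+ j ℤ.- + i)
        ≡⟨ cong (μ ℤ.*_) +[j∸i] ⟨
      μ ℤ.* + (j ∸ i) ∎)

  private
    module Comparison {f} (Φ Ψ : Face f) where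
      module Φ = Face Φ
      module Ψ = Face Ψ

      min≡ : Φ.min ≡ Ψ.min
      min≡ = ℤ.≤-antisym (subst (Φ.min ℤ.≤_) Ψ.weight-first (Φ.min≤weight Ψ.first≢0))
                         (subst (Ψ.min ℤ.≤_) Φ.weight-first (Ψ.min≤weight Φ.first≢0))

      first≤ : Φ.first ≤ Ψ.first
      first≤ = ℕ.≮⇒≥ λ Ψ<Φ → ℤ.<-irrefl (trans min≡ (sym Ψ.weight-first)) (Φ.before-first Ψ<Φ Ψ.first≢0)

      last≥ : Ψ.last ≤ Φ.last
      last≥ = ℕ.≮⇒≥ λ Φ<Ψ → ℤ.<-irrefl (trans min≡ (sym Ψ.weight-last)) (Φ.after-last Φ<Ψ Ψ.last≢0)

  face-unique : ∀ {f} (Φ Ψ : Face f) → Face.first Φ ≡ Face.first Ψ × Face.last Φ ≡ Face.last Ψ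
  face-unique Φ Ψ = ℕ.≤-antisym (Comparison.first≤ Φ Ψ) (Comparison.first≤ Ψ Φ)
                  , ℕ.≤-antisym (Comparison.last≥ Ψ Φ) (Comparison.last≥ Φ Ψ)

  face-between : ∀ {f x y B} → f x ≢ 0ℚ → weight f x ≡ B → f y ≢ 0ℚ → weight f y ≡ B →
                 (∀ {i} → f i ≢ 0ℚ → B ℤ.≤ weight f i) →
                 (∀ {i} → f i ≢ 0ℚ → weight f i ≡ B → x ≤ i × i ≤ y) → Face f
  face-between {f} {x} {y} {B} fx≢0 wx≡B fy≢0 wy≡B B≤w on-face⇒between = record
    { min = B ; first = x ; last = y
    ; first≢0 = fx≢0 ; weight-first = wx≡B ; last≢0 = fy≢0 ; weight-last = wy≡B
    ; min≤weight = B≤w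
    ; before-first = λ j<x fj≢0 → ℤ.≤∧≢⇒< (B≤w fj≢0) λ B≡w →
        ℕ.<⇒≱ j<x (proj₁ (on-face⇒between fj≢0 (sym B≡w)))
    ; after-last = λ y<j fj≢0 → ℤ.≤∧≢⇒< (B≤w fj≢0) λ B≡w →
        ℕ.<⇒≱ y<j (proj₂ (on-face⇒between fj≢0 (sym B≡w)))
    }

  private
    nonzero-below : ∀ {f : ℕ → ℚ} {N} → (∀ {j} → N ≤ j → f j ≡ 0ℚ) → ∀ {i} → f i ≢ 0ℚ → i < N
    nonzero-below vanishes fi≢0 = ℕ.≰⇒> λ N≤i → fi≢0 (vanishes N≤i)

  face : ∀ f N → (∀ {j} → N ≤ j → f j ≡ 0ℚ) → ∀ {j₀} → f j₀ ≢ 0ℚ → Face f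
  face f N vanishes {j₀} fj₀≢0 with minimum-below (λ i → ¬? (f i ≟ 0ℚ)) (weight f) N
  ... | inj₁ none = contradiction fj₀≢0 (none (nonzero-below vanishes fj₀≢0))
  ... | inj₂ m = record
    { min = weight f arg ; first = first ; last = last
    ; first≢0 = proj₁ on-first ; weight-first = proj₂ on-first
    ; last≢0 = proj₁ on-last ; weight-last = proj₂ on-last
    ; min≤weight = min≤weight
    ; before-first = λ j<first fj≢0 → ℤ.≤∧≢⇒< (min≤weight fj≢0) λ eq →
        proj₂ (proj₂ (proj₂ least)) j<first (fj≢0 , sym eq)
    ; after-last = λ last<j fj≢0 → ℤ.≤∧≢⇒< (min≤weight fj≢0) λ eq →
        proj₂ (proj₂ (proj₂ (proj₂ greatest))) last<j (nonzero-below vanishes fj≢0) (fj≢0 , sym eq)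
    }
    where
    open MinimumBelow m
    min≤weight : ∀ {j} → f j ≢ 0ℚ → weight f arg ℤ.≤ weight f j
    min≤weight fj≢0 = minimal (nonzero-below vanishes fj≢0) fj≢0
    OnFace : ℕ → Set
    OnFace i = f i ≢ 0ℚ × weight f i ≡ weight f arg
    onFace? : ∀ i → Dec (OnFace i)
    onFace? i = ¬? (f i ≟ 0ℚ) ×-dec (weight f i ℤ.≟ weight f arg)
    least = least-witness onFace? {arg} (P-arg , refl)
    first = proj₁ least
    on-first = proj₁ (proj₂ least)
    greatest = greatest-witness-below onFace? N (nonzero-below vanishes P-arg) (P-arg , refl)
    last = proj₁ greatest
    on-last = proj₁ (proj₂ greatest)

  Bounded : (ℤ → ℤ → Set) → ℤ → ℚ → Set
  Bounded _R_ c q = q ≡ 0ℚ ⊎ (q ≢ 0ℚ × c R (+ λ′ ℤ.* v q))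

  Attains : ℤ → ℚ → Set
  Attains c q = q ≢ 0ℚ × + λ′ ℤ.* v q ≡ c

  private
    λ′*-mono : ∀ {a b} → a ℤ.≤ b → + λ′ ℤ.* a ℤ.≤ + λ′ ℤ.* b
    λ′*-mono = ℤ.*-monoˡ-≤-nonNeg (+ λ′)

  bounded-+ : ∀ {_R_ c x y} → (∀ {a b} → c R a → a ℤ.≤ b → c R b) →
              Bounded _R_ c x → Bounded _R_ c y → Bounded _R_ c (x ℚ.+ y)
  bounded-+ {_R_} {c} {y = y} R-≤ (inj₁ refl) y-bounded =
    subst (Bounded _R_ c) (sym (ℚ.+-identityˡ y)) y-bounded
  bounded-+ {_R_} {c} {x = x} R-≤ (inj₂ x-bounded) (inj₁ refl) =
    subst (Bounded _R_ c) (sym (ℚ.+-identityʳ x)) (inj₂ x-bounded)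
  bounded-+ {x = x} {y} R-≤ (inj₂ (x≢0 , cRx)) (inj₂ (y≢0 , cRy)) with x ℚ.+ y ≟ 0ℚ
  ... | yes x+y≡0 = inj₁ x+y≡0
  ... | no x+y≢0 with v-+-≥ x≢0 y≢0 x+y≢0
  ...   | inj₁ vx≤ = inj₂ (x+y≢0 , R-≤ cRx (λ′*-mono vx≤))
  ...   | inj₂ vy≤ = inj₂ (x+y≢0 , R-≤ cRy (λ′*-mono vy≤))

  attains-+ : ∀ {c x y} → Attains c x → Bounded ℤ._<_ c y → Attains c (x ℚ.+ y)
  attains-+ {c} {x} x-attains (inj₁ refl) = subst (Attains c) (sym (ℚ.+-identityʳ x)) x-attains
  attains-+ {c} {x} {y} (x≢0 , λvx≡c) (inj₂ (y≢0 , c<λvy)) =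
    proj₁ sum , trans (cong (+ λ′ ℤ.*_) (proj₂ sum)) λvx≡c
    where
    sum = v-+-< x≢0 y≢0 (ℤ.*-cancelˡ-<-nonNeg (+ λ′) (subst (ℤ._< _) (sym λvx≡c) c<λvy))

  attains-+ʳ : ∀ {c x y} → Bounded ℤ._<_ c x → Attains c y → Attains c (x ℚ.+ y)
  attains-+ʳ {c} {x} {y} x-bounded y-attains = subst (Attains c) (ℚ.+-comm y x) (attains-+ y-attains x-bounded)

  private
    i<j+L⇒i∸j<L : ∀ {i j L} → j ≤ i → i < j ℕ.+ L → i ∸ j < L
    i<j+L⇒i∸j<L {i} {j} {L} j≤i i<j+L =
      ℕ.+-cancelˡ-< j (i ∸ j) L (subst (_< j ℕ.+ L) (sym (ℕ.m+[n∸m]≡n j≤i)) i<j+L)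

    j+L<i⇒L<i∸j : ∀ {i j L} → j ≤ i → j ℕ.+ L < i → L < i ∸ j
    j+L<i⇒L<i∸j {i} {j} {L} j≤i j+L<i =
      ℕ.+-cancelˡ-< j L (i ∸ j) (subst (j ℕ.+ L <_) (sym (ℕ.m+[n∸m]≡n j≤i)) j+L<i)

  module _ {g h F : ℕ → ℚ} (F≡g*h : ∀ i → F i ≡ conv g h i) (Φg : Face g) (Φh : Face h) where

    private
      module Φg = Face Φg
      module Φh = Face Φh

      M : ℤ
      M = Φg.min ℤ.+ Φh.min

      shifted : ℕ → ℤ
      shifted i = M ℤ.- μ ℤ.* + i

      term : ℕ → ℕ → ℚ
      term i j = g j ℚ.* h (i ∸ j)

      PairWeight : (ℤ → ℤ → Set) → ℕ → ℕ → Set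
      PairWeight _R_ i j = g j ≢ 0ℚ → h (i ∸ j) ≢ 0ℚ → M R (weight g j ℤ.+ weight h (i ∸ j))

      term-weight : ∀ {i j} → j ≤ i → g j ≢ 0ℚ → h (i ∸ j) ≢ 0ℚ →
                    term i j ≢ 0ℚ × + λ′ ℤ.* v (term i j) ≡ (weight g j ℤ.+ weight h (i ∸ j)) ℤ.- μ ℤ.* + i
      term-weight {i} {j} j≤i gj≢0 hij≢0 = proj₁ product , (begin
        + λ′ ℤ.* v (term i j)
          ≡⟨ cong (+ λ′ ℤ.*_) (proj₂ product) ⟩
        + λ′ ℤ.* (v (g j) ℤ.+ v (h (i ∸ j)))
          ≡⟨ regroup (+ λ′) (v (g j)) (v (h (i ∸ j))) μ (+ j) (+ i) ⟩
        (weight g j ℤ.+ (+ λ′ ℤ.* v (h (i ∸ j)) ℤ.+ μ ℤ.* (+ i ℤ.- + j))) ℤ.- μ ℤ.* + i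
          ≡⟨ cong (λ z → (weight g j ℤ.+ (+ λ′ ℤ.* v (h (i ∸ j)) ℤ.+ μ ℤ.* z)) ℤ.- μ ℤ.* + i) (sym +[i∸j]) ⟩
        (weight g j ℤ.+ weight h (i ∸ j)) ℤ.- μ ℤ.* + i ∎)
        where
        open ≡-Reasoning
        product = v-* gj≢0 hij≢0
        +[i∸j] : + (i ∸ j) ≡ + i ℤ.- + j
        +[i∸j] = trans (sym (ℤ.⊖-≥ j≤i)) (sym (ℤ.m-n≡m⊖n i j))
        regroup : ∀ L a b m J I →
                  L ℤ.* (a ℤ.+ b) ≡ ((L ℤ.* a ℤ.+ m ℤ.* J) ℤ.+ (L ℤ.* b ℤ.+ m ℤ.* (I ℤ.- J))) ℤ.- m ℤ.* I
        regroup = solve-∀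

      term-bounded : ∀ {_R_ i j} → (∀ {a b} → a R b → (a ℤ.- μ ℤ.* + i) R (b ℤ.- μ ℤ.* + i)) →
                     j ≤ i → PairWeight _R_ i j → Bounded _R_ (shifted i) (term i j)
      term-bounded {_R_} {i} {j} shift j≤i pair with g j ≟ 0ℚ | h (i ∸ j) ≟ 0ℚ
      ... | yes gj≡0 | _ = inj₁ (trans (cong (ℚ._* h (i ∸ j)) gj≡0) (ℚ.*-zeroˡ (h (i ∸ j))))
      ... | no _ | yes hij≡0 = inj₁ (trans (cong (g j ℚ.*_) hij≡0) (ℚ.*-zeroʳ (g j)))
      ... | no gj≢0 | no hij≢0 = inj₂ (proj₁ t , subst (shifted i R_) (sym (proj₂ t)) (shift (pair gj≢0 hij≢0)))
        where t = term-weight j≤i gj≢0 hij≢0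

      F≡sum : ∀ i → F i ≡ sumUpTo (term i) (suc i)
      F≡sum i = trans (F≡g*h i) (conv≡sumUpTo g h i)

      coefficient-bounded : ∀ {_R_} i → (∀ {c a b} → c R a → a ℤ.≤ b → c R b) →
                            (∀ {a b} → a R b → (a ℤ.- μ ℤ.* + i) R (b ℤ.- μ ℤ.* + i)) →
                            (∀ {j} → j ≤ i → PairWeight _R_ i j) → Bounded _R_ (shifted i) (F i)
      coefficient-bounded {_R_} i R-≤ shift pair = subst (Bounded _R_ (shifted i)) (sym (F≡sum i))
        (sumUpTo-preserves {P = Bounded _R_ (shifted i)} (inj₁ refl) (bounded-+ {_R_} {shifted i} R-≤) (term i) (suc i)
                           λ j<1+i → term-bounded {_R_} shift (ℕ.≤-pred j<1+i) (pair (ℕ.≤-pred j<1+i)))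

      coefficient-attains : ∀ i {j₀} → j₀ ≤ i → g j₀ ≢ 0ℚ → h (i ∸ j₀) ≢ 0ℚ →
                            weight g j₀ ℤ.+ weight h (i ∸ j₀) ≡ M →
                            (∀ {j} → j ≤ i → j ≢ j₀ → PairWeight ℤ._<_ i j) → Attains (shifted i) (F i)
      coefficient-attains i {j₀} j₀≤i gj₀≢0 hij₀≢0 on-face off-face = subst (Attains (shifted i)) (sym (F≡sum i))
        (sumUpTo-dominated {P = Bounded ℤ._<_ (shifted i)} (inj₁ refl) (bounded-+ {ℤ._<_} {shifted i} ℤ.<-≤-trans)
           {Q = Attains (shifted i)} attains-+ attains-+ʳ (term i) (suc i) (s<s j₀≤i) j₀-attains
           λ j<1+i j≢j₀ → term-bounded {ℤ._<_} (ℤ.+-monoˡ-< _) (ℕ.≤-pred j<1+i) (off-face (ℕ.≤-pred j<1+i) j≢j₀))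
        where
        t = term-weight j₀≤i gj₀≢0 hij₀≢0
        j₀-attains : Attains (shifted i) (term i j₀)
        j₀-attains = proj₁ t , trans (proj₂ t) (cong (ℤ._- μ ℤ.* + i) on-face)

      shifted+μi≡M : ∀ i → shifted i ℤ.+ μ ℤ.* + i ≡ M
      shifted+μi≡M i = cancel M (μ ℤ.* + i)
        where
        cancel : ∀ a b → a ℤ.- b ℤ.+ b ≡ a
        cancel = solve-∀

      min≤weight : ∀ {i} → F i ≢ 0ℚ → M ℤ.≤ weight F i
      min≤weight {i} Fi≢0 with coefficient-bounded {ℤ._≤_} i ℤ.≤-trans (ℤ.+-monoˡ-≤ _) pair
        where
        pair : ∀ {j} → j ≤ i → PairWeight ℤ._≤_ i j
        pair _ gj≢0 hij≢0 = ℤ.+-mono-≤ (Φg.min≤weight gj≢0) (Φh.min≤weight hij≢0)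
      ... | inj₁ Fi≡0 = contradiction Fi≡0 Fi≢0
      ... | inj₂ (_ , shifted≤) =
        subst (ℤ._≤ weight F i) (shifted+μi≡M i) (ℤ.+-monoˡ-≤ (μ ℤ.* + i) shifted≤)

      min<weight : ∀ {i} → F i ≢ 0ℚ → (∀ {j} → j ≤ i → PairWeight ℤ._<_ i j) → M ℤ.< weight F i
      min<weight {i} Fi≢0 pair with coefficient-bounded {ℤ._<_} i ℤ.<-≤-trans (ℤ.+-monoˡ-< _) pair
      ... | inj₁ Fi≡0 = contradiction Fi≡0 Fi≢0
      ... | inj₂ (_ , shifted<) =
        subst (ℤ._< weight F i) (shifted+μi≡M i) (ℤ.+-monoˡ-< (μ ℤ.* + i) shifted<)

      attains⇒on-face : ∀ {i} → Attains (shifted i) (F i) → F i ≢ 0ℚ × weight F i ≡ M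
      attains⇒on-face {i} (Fi≢0 , λvFi≡shifted) =
        Fi≢0 , trans (cong (ℤ._+ μ ℤ.* + i) λvFi≡shifted) (shifted+μi≡M i)

      on-face-at : ∀ {a b} → g a ≢ 0ℚ → h b ≢ 0ℚ → weight g a ℤ.+ weight h b ≡ M →
                   (∀ {j} → j < a → j ≤ a ℕ.+ b → PairWeight ℤ._<_ (a ℕ.+ b) j) →
                   (∀ {j} → a < j → j ≤ a ℕ.+ b → PairWeight ℤ._<_ (a ℕ.+ b) j) →
                   F (a ℕ.+ b) ≢ 0ℚ × weight F (a ℕ.+ b) ≡ M
      on-face-at {a} {b} ga≢0 hb≢0 weight≡M below above = attains⇒on-face
        (coefficient-attains (a ℕ.+ b) (ℕ.m≤m+n a b) ga≢0 (subst (λ z → h z ≢ 0ℚ) (sym a+b∸a≡b) hb≢0)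
           (subst (λ z → weight g a ℤ.+ weight h z ≡ M) (sym a+b∸a≡b) weight≡M) off-face)
        where
        a+b∸a≡b : a ℕ.+ b ∸ a ≡ b
        a+b∸a≡b = ℕ.m+n∸m≡n a b
        off-face : ∀ {j} → j ≤ a ℕ.+ b → j ≢ a → PairWeight ℤ._<_ (a ℕ.+ b) j
        off-face {j} j≤a+b j≢a with ℕ.<-cmp j a
        ... | tri< j<a _ _ = below j<a j≤a+b
        ... | tri≈ _ j≡a _ = contradiction j≡a j≢a
        ... | tri> _ _ a<j = above a<j j≤a+b

    -- In the coefficients of x^(first g + first h) and x^(last g + last h) a single term has
    -- the least weight, so it cannot be cancelled.
    face-* : Face F
    face-* = record
      { min = M ; first = Φg.first ℕ.+ Φh.first ; last = Φg.last ℕ.+ Φh.last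
      ; first≢0 = proj₁ on-first ; weight-first = proj₂ on-first
      ; last≢0 = proj₁ on-last ; weight-last = proj₂ on-last
      ; min≤weight = min≤weight
      ; before-first = λ i<first Fi≢0 → min<weight Fi≢0 (before-first i<first)
      ; after-last = λ last<i Fi≢0 → min<weight Fi≢0 (after-last last<i)
      }
      where
      before-first : ∀ {i} → i < Φg.first ℕ.+ Φh.first → ∀ {j} → j ≤ i → PairWeight ℤ._<_ i j
      before-first i<first {j} j≤i gj≢0 hij≢0 with j ℕ.<? Φg.first
      ... | yes j<first = ℤ.+-mono-<-≤ (Φg.before-first j<first gj≢0) (Φh.min≤weight hij≢0)
      ... | no j≮first = ℤ.+-mono-≤-< (Φg.min≤weight gj≢0) (Φh.before-first
              (i<j+L⇒i∸j<L j≤i (ℕ.<-≤-trans i<first (ℕ.+-monoˡ-≤ Φh.first (ℕ.≮⇒≥ j≮first)))) hij≢0)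

      after-last : ∀ {i} → Φg.last ℕ.+ Φh.last < i → ∀ {j} → j ≤ i → PairWeight ℤ._<_ i j
      after-last last<i {j} j≤i gj≢0 hij≢0 with Φg.last ℕ.<? j
      ... | yes last<j = ℤ.+-mono-<-≤ (Φg.after-last last<j gj≢0) (Φh.min≤weight hij≢0)
      ... | no last≮j = ℤ.+-mono-≤-< (Φg.min≤weight gj≢0) (Φh.after-last
              (j+L<i⇒L<i∸j j≤i (ℕ.≤-<-trans (ℕ.+-monoˡ-≤ Φh.last (ℕ.≮⇒≥ last≮j)) last<i)) hij≢0)

      on-first : F (Φg.first ℕ.+ Φh.first) ≢ 0ℚ × weight F (Φg.first ℕ.+ Φh.first) ≡ M
      on-first = on-face-at Φg.first≢0 Φh.first≢0 (cong₂ ℤ._+_ Φg.weight-first Φh.weight-first)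
        (λ j<first _ gj≢0 hij≢0 → ℤ.+-mono-<-≤ (Φg.before-first j<first gj≢0) (Φh.min≤weight hij≢0))
        (λ first<j j≤i gj≢0 hij≢0 → ℤ.+-mono-≤-< (Φg.min≤weight gj≢0)
           (Φh.before-first (i<j+L⇒i∸j<L j≤i (ℕ.+-monoˡ-< Φh.first first<j)) hij≢0))

      on-last : F (Φg.last ℕ.+ Φh.last) ≢ 0ℚ × weight F (Φg.last ℕ.+ Φh.last) ≡ M
      on-last = on-face-at Φg.last≢0 Φh.last≢0 (cong₂ ℤ._+_ Φg.weight-last Φh.weight-last)
        (λ j<last j≤i gj≢0 hij≢0 → ℤ.+-mono-≤-< (Φg.min≤weight gj≢0)
           (Φh.after-last (j+L<i⇒L<i∸j j≤i (ℕ.+-monoˡ-< Φh.last j<last)) hij≢0))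
        (λ last<j _ gj≢0 hij≢0 → ℤ.+-mono-<-≤ (Φg.after-last last<j gj≢0) (Φh.min≤weight hij≢0))

module Polynomials where

  open import Data.Nat as ℕ using (suc; _<_; _≤_; _+_; _∸_; _<?_)
  import Data.Nat.Properties as ℕ
  open import Data.Rational as ℚ using (ℚ; 0ℚ; 1ℚ; _≟_)
  import Data.Rational.Properties as ℚ
  open import Data.Fin using (fromℕ)
  open import Data.Fin.Properties using (fromℕ-def)
  open import Data.Vec using (Vec; lookup)
  open import Data.Product using (∃; _×_; _,_)
  open import Relation.Nullary using (yes; no; contradiction; ¬?)
  open import Relation.Binary using (tri<; tri≈; tri>)
  open import Relation.Binary.PropositionalEquality
  open import Defs using (vcoeff; conv)
  open RationalSums
  open BoundedSearch

  vcoeff-vanishes : ∀ {m} (w : Vec ℚ m) {j} → m ≤ j → vcoeff w j ≡ 0ℚ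
  vcoeff-vanishes {m} w {j} m≤j with j <? m
  ... | yes j<m = contradiction m≤j (ℕ.<⇒≱ j<m)
  ... | no _    = refl

  vcoeff-last : ∀ {d} (w : Vec ℚ (suc d)) → vcoeff w d ≡ lookup w (fromℕ d)
  vcoeff-last {d} w with d <? suc d
  ... | yes _   = cong (lookup w) (sym (fromℕ-def d))
  ... | no d≮1+d = contradiction ℕ.≤-refl d≮1+d

  Degree : (ℕ → ℚ) → ℕ → Set
  Degree f d = f d ≢ 0ℚ × (∀ {j} → d < j → f j ≡ 0ℚ)

  degree : ∀ (f : ℕ → ℚ) N → (∀ {j} → N ≤ j → f j ≡ 0ℚ) → ∀ {j₀} → f j₀ ≢ 0ℚ → ∃ (Degree f)
  degree f N vanishes {j₀} fj₀≢0
    with greatest-witness-below (λ i → ¬? (f i ≟ 0ℚ)) N (ℕ.≰⇒> λ N≤j₀ → fj₀≢0 (vanishes N≤j₀)) fj₀≢0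
  ... | d , fd≢0 , _ , _ , greatest = d , fd≢0 , above
    where
    above : ∀ {j} → d < j → f j ≡ 0ℚ
    above {j} d<j with j <? N | f j ≟ 0ℚ
    ... | _       | yes fj≡0 = fj≡0
    ... | yes j<N | no fj≢0  = contradiction fj≢0 (greatest d<j j<N)
    ... | no j≮N  | no _     = vanishes (ℕ.≮⇒≥ j≮N)

  conv-0 : ∀ f g → conv f g 0 ≡ f 0 ℚ.* g 0
  conv-0 f g = ℚ.+-identityʳ (f 0 ℚ.* g 0)

  p≢0∧q≢0⇒p*q≢0 : ∀ {x y} → x ≢ 0ℚ → y ≢ 0ℚ → x ℚ.* y ≢ 0ℚ
  p≢0∧q≢0⇒p*q≢0 {x} {y} x≢0 y≢0 xy≡0 = y≢0 (begin
    y                      ≡⟨ ℚ.*-identityˡ y ⟨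
    1ℚ ℚ.* y               ≡⟨ cong (ℚ._* y) (ℚ.*-inverseˡ x) ⟨
    ℚ.1/ x ℚ.* x ℚ.* y     ≡⟨ ℚ.*-assoc (ℚ.1/ x) x y ⟩
    ℚ.1/ x ℚ.* (x ℚ.* y)   ≡⟨ cong (ℚ.1/ x ℚ.*_) xy≡0 ⟩
    ℚ.1/ x ℚ.* 0ℚ          ≡⟨ ℚ.*-zeroʳ (ℚ.1/ x) ⟩
    0ℚ                     ∎)
    where
    open ≡-Reasoning
    instance _ = ℚ.≢-nonZero x≢0

  conv-degree : ∀ {f g d e} → Degree f d → Degree g e → conv f g (d + e) ≢ 0ℚ
  conv-degree {f} {g} {d} {e} (fd≢0 , f-above) (ge≢0 , g-above) =
    subst (_≢ 0ℚ) (sym (conv≡sumUpTo f g (d + e)))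
      (sumUpTo-dominated {P = _≡ 0ℚ} refl (λ x≡0 y≡0 → trans (cong₂ ℚ._+_ x≡0 y≡0) (ℚ.+-identityʳ 0ℚ))
        {Q = _≢ 0ℚ}
        (λ {x} x≢0 y≡0 → subst (_≢ 0ℚ) (sym (trans (cong (x ℚ.+_) y≡0) (ℚ.+-identityʳ x))) x≢0)
        (λ {_} {y} x≡0 y≢0 → subst (_≢ 0ℚ) (sym (trans (cong (ℚ._+ y) x≡0) (ℚ.+-identityˡ y))) y≢0)
        _ (suc (d + e)) (ℕ.s≤s (ℕ.m≤m+n d e)) leading other)
    where
    leading : f d ℚ.* g (d + e ∸ d) ≢ 0ℚ
    leading = subst (λ i → f d ℚ.* g i ≢ 0ℚ) (sym (ℕ.m+n∸m≡n d e)) (p≢0∧q≢0⇒p*q≢0 fd≢0 ge≢0)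
    other : ∀ {j} → j < suc (d + e) → j ≢ d → f j ℚ.* g (d + e ∸ j) ≡ 0ℚ
    other {j} j<1+d+e j≢d with ℕ.<-cmp j d
    ... | tri≈ _ j≡d _ = contradiction j≡d j≢d
    ... | tri> _ _ d<j = trans (cong (ℚ._* g (d + e ∸ j)) (f-above d<j)) (ℚ.*-zeroˡ (g (d + e ∸ j)))
    ... | tri< j<d _ _ = trans (cong (f j ℚ.*_) (g-above e<d+e∸j)) (ℚ.*-zeroʳ (f j))
      where
      e<d+e∸j : e < d + e ∸ j
      e<d+e∸j = ℕ.+-cancelˡ-< j e (d + e ∸ j)
        (subst (j + e <_) (sym (ℕ.m+[n∸m]≡n (ℕ.≤-pred j<1+d+e))) (ℕ.+-monoˡ-< e j<d))

module OppositeSlopes {p : ℕ} (p-prime : Prime p) (L K e : ℕ) where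

  open import Data.Nat as ℕ using (_<_; _≤_; _+_)
  import Data.Nat.Properties as ℕ
  open import Data.Integer as ℤ using (ℤ; +_; -_; 0ℤ)
  import Data.Integer.Properties as ℤ
  open import Data.Integer.Tactic.RingSolver using (solve-∀)
  open import Relation.Binary.PropositionalEquality

  module Falling = NewtonFace p-prime L (+ e)
  module Rising  = NewtonFace p-prime K (- + e)

  private
    0≤m*z : ∀ m {z} → 0ℤ ℤ.≤ z → 0ℤ ℤ.≤ + m ℤ.* z
    0≤m*z m {z} 0≤z = subst (ℤ._≤ + m ℤ.* z) (ℤ.*-zeroʳ (+ m)) (ℤ.*-monoˡ-≤-nonNeg (+ m) 0≤z)

    -- K times the first inequality plus L times the second is (K + L) e (r − s) ≥ 0.
    crossed-weights : ∀ {vs vr : ℤ} {s r : ℕ} → 0 < K + L → 0 < e →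
      + L ℤ.* vs ℤ.+ + e ℤ.* + s ℤ.≤ + L ℤ.* vr ℤ.+ + e ℤ.* + r →
      + K ℤ.* vr ℤ.+ (- + e) ℤ.* + r ℤ.≤ + K ℤ.* vs ℤ.+ (- + e) ℤ.* + s →
      s ≤ r
    crossed-weights {vs} {vr} {s} {r} 0<K+L 0<e falling rising =
      ℤ.drop‿+≤+ (ℤ.0≤i-j⇒j≤i (ℤ.*-cancelˡ-≤-pos 0ℤ (+ r ℤ.- + s) scale {{ℤ.positive 0<scale}}
        (subst (ℤ._≤ scale ℤ.* (+ r ℤ.- + s)) (sym (ℤ.*-zeroʳ scale)) 0≤scale*[r-s])))
      where
      scale = (+ K ℤ.+ + L) ℤ.* + e
      0<scale : 0ℤ ℤ.< scale
      0<scale = subst (0ℤ ℤ.<_) (trans (ℤ.pos-* (K + L) e) (cong (ℤ._* + e) (ℤ.pos-+ K L)))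
                  (ℤ.+<+ (ℕ.*-mono-≤ 0<K+L 0<e))
      combine : ∀ K L e vs vr s r →
        K ℤ.* ((L ℤ.* vr ℤ.+ e ℤ.* r) ℤ.- (L ℤ.* vs ℤ.+ e ℤ.* s)) ℤ.+
        L ℤ.* ((K ℤ.* vs ℤ.+ (ℤ.- e) ℤ.* s) ℤ.- (K ℤ.* vr ℤ.+ (ℤ.- e) ℤ.* r))
        ≡ ((K ℤ.+ L) ℤ.* e) ℤ.* (r ℤ.- s)
      combine = solve-∀
      0≤scale*[r-s] : 0ℤ ℤ.≤ scale ℤ.* (+ r ℤ.- + s)
      0≤scale*[r-s] = subst (0ℤ ℤ.≤_) (combine (+ K) (+ L) (+ e) vs vr (+ s) (+ r))
        (ℤ.+-mono-≤ (0≤m*z K (ℤ.i≤j⇒0≤j-i falling)) (0≤m*z L (ℤ.i≤j⇒0≤j-i rising)))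

  last≤first : ∀ {f} → 0 < K + L → 0 < e → (Φ : Falling.Face f) (Ψ : Rising.Face f) →
               Falling.Face.last Φ ≤ Rising.Face.first Ψ
  last≤first {f} 0<K+L 0<e Φ Ψ = crossed-weights 0<K+L 0<e
    (subst (ℤ._≤ Falling.weight f Ψ.first) (sym Φ.weight-last) (Φ.min≤weight Ψ.first≢0))
    (subst (ℤ._≤ Rising.weight f Φ.last) (sym Ψ.weight-first) (Ψ.min≤weight Φ.last≢0))
    where
    module Φ = Falling.Face Φ
    module Ψ = Rising.Face Ψ

module FactorSegments {p : ℕ} (p-prime : Prime p) (L K e : ℕ) (0<K : 0 < K) (0<e : 0 < e) where

  open import Data.Nat as ℕ using (suc; _<_; _≤_; _+_; _∸_; _*_)
  import Data.Nat.Properties as ℕ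
  open import Data.Nat.Divisibility using (_∣_)
  open import Data.Integer as ℤ using (+_)
  import Data.Integer.Properties as ℤ
  open import Data.Rational as ℚ using (ℚ; 0ℚ)
  import Data.Rational.Properties as ℚ
  open import Data.Product using (_×_; _,_; proj₁; proj₂)
  open import Relation.Binary.PropositionalEquality
  open import Defs using (conv)
  open Polynomials
  open OppositeSlopes p-prime L K e

  record SegmentSplit (d : ℕ) : Set where
    field
      s t   : ℕ
      d≡s+t : d ≡ s + t
      s≤L   : s ≤ L
      t≤K   : t ≤ K
      L∣e*s : L ∣ e * s
      K∣e*t : K ∣ e * t

  module _ {F g h : ℕ → ℚ} (F≡g*h : ∀ i → F i ≡ conv g h i)
           (F-falling : ∀ (Φ : Falling.Face F) → Falling.Face.first Φ ≡ 0 × Falling.Face.last Φ ≡ L)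
           (F-rising : ∀ (Ψ : Rising.Face F) → Rising.Face.first Ψ ≡ L × Rising.Face.last Ψ ≡ L + K)
           (F-vanishes : ∀ {i} → L + K < i → F i ≡ 0ℚ)
           {d} (deg-g : Degree g d) (N : ℕ) (h-vanishes : ∀ {j} → N ≤ j → h j ≡ 0ℚ) (F0≢0 : F 0 ≢ 0ℚ) where

    private
      g0h0≢0 : g 0 ℚ.* h 0 ≢ 0ℚ
      g0h0≢0 g0h0≡0 = F0≢0 (trans (F≡g*h 0) (trans (conv-0 g h) g0h0≡0))
      g0≢0 : g 0 ≢ 0ℚ
      g0≢0 g0≡0 = g0h0≢0 (trans (cong (ℚ._* h 0) g0≡0) (ℚ.*-zeroˡ (h 0)))
      h0≢0 : h 0 ≢ 0ℚ
      h0≢0 h0≡0 = g0h0≢0 (trans (cong (g 0 ℚ.*_) h0≡0) (ℚ.*-zeroʳ (g 0)))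

      Φg = Falling.face g (suc d) (proj₂ deg-g) g0≢0
      Φh = Falling.face h N h-vanishes h0≢0
      Ψg = Rising.face g (suc d) (proj₂ deg-g) g0≢0
      Ψh = Rising.face h N h-vanishes h0≢0
      module Φg = Falling.Face Φg
      module Φh = Falling.Face Φh
      module Ψg = Rising.Face Ψg
      module Ψh = Rising.Face Ψh

      falling-ends : Φg.first + Φh.first ≡ 0 × Φg.last + Φh.last ≡ L
      falling-ends = F-falling (Falling.face-* F≡g*h Φg Φh)

      rising-ends : Ψg.first + Ψh.first ≡ L × Ψg.last + Ψh.last ≡ L + K
      rising-ends = F-rising (Rising.face-* F≡g*h Ψg Ψh)

      0<K+L : 0 < K + L
      0<K+L = ℕ.<-≤-trans 0<K (ℕ.m≤m+n K L)

      s≡r : Φg.last ≡ Ψg.first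
      s≡r = ℕ.≤-antisym (last≤first 0<K+L 0<e Φg Ψg) (ℕ.+-cancelʳ-≤ Ψh.first Ψg.first Φg.last (begin
        Ψg.first + Ψh.first ≡⟨ trans (proj₁ rising-ends) (sym (proj₂ falling-ends)) ⟩
        Φg.last + Φh.last   ≤⟨ ℕ.+-monoʳ-≤ Φg.last (last≤first 0<K+L 0<e Φh Ψh) ⟩
        Φg.last + Ψh.first  ∎))
        where open ℕ.≤-Reasoning

      last[Ψg]≡d : Ψg.last ≡ d
      last[Ψg]≡d with degree h N h-vanishes h0≢0
      ... | dh , deg-h = ℕ.≤-antisym (ℕ.≮⇒≥ λ d<last → Ψg.last≢0 (proj₂ deg-g d<last))
        (ℕ.+-cancelʳ-≤ dh d Ψg.last (begin
          d + dh              ≤⟨ ℕ.≮⇒≥ (λ L+K<d+dh → conv-degree deg-g deg-h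
                                   (trans (sym (F≡g*h (d + dh))) (F-vanishes L+K<d+dh))) ⟩
          L + K               ≡⟨ proj₂ rising-ends ⟨
          Ψg.last + Ψh.last   ≤⟨ ℕ.+-monoʳ-≤ Ψg.last (ℕ.≮⇒≥ λ dh<last → Ψh.last≢0 (proj₂ deg-h dh<last)) ⟩
          Ψg.last + dh        ∎))
        where open ℕ.≤-Reasoning

    factor-segments : SegmentSplit d
    factor-segments = record
      { s = Φg.last ; t = d ∸ Φg.last
      ; d≡s+t = sym (ℕ.m+[n∸m]≡n s≤d)
      ; s≤L = subst (Φg.last ≤_) (proj₂ falling-ends) (ℕ.m≤m+n Φg.last Φh.last)
      ; t≤K = ℕ.+-cancelʳ-≤ L (d ∸ Φg.last) K (begin
          d ∸ Φg.last + L                      ≡⟨ cong (λ m → d ∸ Φg.last + m) (proj₁ rising-ends) ⟨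
          d ∸ Φg.last + (Ψg.first + Ψh.first)  ≡⟨ ℕ.+-assoc (d ∸ Φg.last) Ψg.first Ψh.first ⟨
          d ∸ Φg.last + Ψg.first + Ψh.first    ≡⟨ cong (λ r → d ∸ Φg.last + r + Ψh.first) s≡r ⟨
          d ∸ Φg.last + Φg.last + Ψh.first     ≡⟨ cong (_+ Ψh.first) (ℕ.m∸n+n≡m s≤d) ⟩
          d + Ψh.first                         ≤⟨ ℕ.+-monoʳ-≤ d (Rising.first≤last Ψh) ⟩
          d + Ψh.last                          ≡⟨ cong (_+ Ψh.last) last[Ψg]≡d ⟨
          Ψg.last + Ψh.last                    ≡⟨ proj₂ rising-ends ⟩
          L + K                                ≡⟨ ℕ.+-comm L K ⟩
          K + L                                ∎)
      ; L∣e*s = Falling.equal-weights⇒λ∣∣μ∣*[j∸i] {g} ℕ.z≤n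
          (trans (cong (Falling.weight g) (sym first[Φg]≡0)) (trans Φg.weight-first (sym Φg.weight-last)))
      ; K∣e*t = subst₂ (λ x y → K ∣ x * (d ∸ y)) (ℤ.∣-i∣≡∣i∣ (+ e)) (sym s≡r)
          (Rising.equal-weights⇒λ∣∣μ∣*[j∸i] {g} (subst (_≤ d) s≡r s≤d)
            (trans Ψg.weight-first (trans (sym Ψg.weight-last) (cong (Rising.weight g) last[Ψg]≡d))))
      }
      where
      open ℕ.≤-Reasoning
      s≤d : Φg.last ≤ d
      s≤d = subst₂ _≤_ (sym s≡r) last[Ψg]≡d (Rising.first≤last Ψg)
      first[Φg]≡0 : Φg.first ≡ 0
      first[Φg]≡0 = ℕ.m+n≡0⇒m≡0 Φg.first (proj₁ falling-ends)

-- The Newton polygon of F has vertices (0, V), (L, V − e) and (L + K, V).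
module TwoSegmentPolygon {p : ℕ} (p-prime : Prime p) {L K e : ℕ} (0<L : 0 < L) (0<K : 0 < K) (0<e : 0 < e)
  {F : ℕ → ℚ} (V : ℤ)
  (F-vanishes : ∀ {i} → L + K < i → F i ≡ 0ℚ) (F≢0 : ∀ {i} → i ≤ L + K → F i ≢ 0ℚ)
  (v-off : ∀ {i} → i ≤ L + K → i ≢ L → Valuation.v p-prime (F i) ≡ V)
  (v-at-L : Valuation.v p-prime (F L) ℤ.+ ℤ.+ e ≡ V) where

  open import Data.Nat as ℕ using (_∸_; _*_)
  import Data.Nat.Properties as ℕ
  open import Data.Integer as ℤ using (+_; -_)
  import Data.Integer.Properties as ℤ
  open import Data.Integer.Tactic.RingSolver using (solve-∀)
  open import Data.Product using (_×_; _,_; proj₁; proj₂)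
  open import Data.Sum using ([_,_]′)
  open import Relation.Nullary using (yes; no; contradiction)
  open import Relation.Binary.PropositionalEquality
  open Valuation p-prime using (v)
  open OppositeSlopes p-prime L K e
  open ≡-Reasoning

  private
    F-support : ∀ {i} → F i ≢ 0ℚ → i ≤ L + K
    F-support Fi≢0 = ℕ.≮⇒≥ λ L+K<i → Fi≢0 (F-vanishes L+K<i)

    above-by : ∀ {w B} m → w ≡ B ℤ.+ + (e * m) → B ℤ.≤ w × (w ≡ B → m ≡ 0)
    above-by {B = B} m refl = ℤ.i≤i+j B (+ (e * m)) , m≡0
      where
      cancel : ∀ b x → x ≡ (b ℤ.+ x) ℤ.- b
      cancel = solve-∀
      m≡0 : B ℤ.+ + (e * m) ≡ B → m ≡ 0
      m≡0 w≡B = [ (λ e≡0 → contradiction e≡0 (ℕ.>⇒≢ 0<e)) , (λ m≡0 → m≡0) ]′ (ℕ.m*n≡0⇒m≡0∨n≡0 e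
        (ℤ.+-injective (trans (cancel B (+ (e * m))) (trans (cong (ℤ._- B) w≡B) (ℤ.+-inverseʳ B)))))

    falling-off : ∀ {i} → i ≤ L + K → i ≢ L → Falling.weight F i ≡ + L ℤ.* V ℤ.+ + (e * i)
    falling-off {i} i≤L+K i≢L = cong₂ ℤ._+_ (cong (+ L ℤ.*_) (v-off i≤L+K i≢L)) (sym (ℤ.pos-* e i))

    falling-at-L : Falling.weight F L ≡ + L ℤ.* V
    falling-at-L = begin
      + L ℤ.* v (F L) ℤ.+ + e ℤ.* + L ≡⟨ factor (+ L) (v (F L)) (+ e) ⟩
      + L ℤ.* (v (F L) ℤ.+ + e)       ≡⟨ cong (+ L ℤ.*_) v-at-L ⟩
      + L ℤ.* V                       ∎
      where
      factor : ∀ l x y → l ℤ.* x ℤ.+ y ℤ.* l ≡ l ℤ.* (x ℤ.+ y)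
      factor = solve-∀

    falling-face : Falling.Face F
    falling-face = Falling.face-between (F≢0 ℕ.z≤n) on-0 (F≢0 (ℕ.m≤m+n L K)) falling-at-L
      min≤weight (λ Fi≢0 w≡B → ℕ.z≤n , on-face⇒≤L Fi≢0 w≡B)
      where
      0≢L : 0 ≢ L
      0≢L = ℕ.<⇒≢ 0<L
      on-0 : Falling.weight F 0 ≡ + L ℤ.* V
      on-0 = trans (falling-off ℕ.z≤n 0≢L) (trans (cong (λ x → + L ℤ.* V ℤ.+ + x) (ℕ.*-zeroʳ e)) (ℤ.+-identityʳ _))
      min≤weight : ∀ {i} → F i ≢ 0ℚ → + L ℤ.* V ℤ.≤ Falling.weight F i
      min≤weight {i} Fi≢0 with i ℕ.≟ L
      ... | yes refl = ℤ.≤-reflexive (sym falling-at-L)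
      ... | no i≢L = proj₁ (above-by i (falling-off (F-support Fi≢0) i≢L))
      on-face⇒≤L : ∀ {i} → F i ≢ 0ℚ → Falling.weight F i ≡ + L ℤ.* V → i ≤ L
      on-face⇒≤L {i} Fi≢0 w≡B with i ℕ.≟ L
      ... | yes refl = ℕ.≤-refl
      ... | no i≢L = subst (_≤ L) (sym (proj₂ (above-by i (falling-off (F-support Fi≢0) i≢L)) w≡B)) ℕ.z≤n

    B : ℤ
    B = + K ℤ.* V ℤ.- + e ℤ.* + (L + K)

    rising-off : ∀ {i} → i ≤ L + K → i ≢ L → Rising.weight F i ≡ B ℤ.+ + (e * (L + K ∸ i))
    rising-off {i} i≤L+K i≢L = begin
      + K ℤ.* v (F i) ℤ.+ (- + e) ℤ.* + i
        ≡⟨ cong (λ x → + K ℤ.* x ℤ.+ (- + e) ℤ.* + i) (v-off i≤L+K i≢L) ⟩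
      + K ℤ.* V ℤ.+ (- + e) ℤ.* + i
        ≡⟨ shift (+ K ℤ.* V) (+ e) (+ (L + K)) (+ i) ⟩
      B ℤ.+ + e ℤ.* (+ (L + K) ℤ.- + i)
        ≡⟨ cong (λ x → B ℤ.+ + e ℤ.* x) (trans (ℤ.m-n≡m⊖n (L + K) i) (ℤ.⊖-≥ i≤L+K)) ⟩
      B ℤ.+ + e ℤ.* + (L + K ∸ i)
        ≡⟨ cong (λ x → B ℤ.+ x) (ℤ.pos-* e (L + K ∸ i)) ⟨
      B ℤ.+ + (e * (L + K ∸ i)) ∎
      where
      shift : ∀ a e n i → a ℤ.+ (- e) ℤ.* i ≡ (a ℤ.- e ℤ.* n) ℤ.+ e ℤ.* (n ℤ.- i)
      shift = solve-∀

    rising-at-L : Rising.weight F L ≡ B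
    rising-at-L = begin
      + K ℤ.* v (F L) ℤ.+ (- + e) ℤ.* + L
        ≡⟨ regroup (+ K) (v (F L)) (+ e) (+ L) ⟩
      + K ℤ.* (v (F L) ℤ.+ + e) ℤ.- + e ℤ.* (+ L ℤ.+ + K)
        ≡⟨ cong₂ (λ x y → + K ℤ.* x ℤ.- + e ℤ.* y) v-at-L (sym (ℤ.pos-+ L K)) ⟩
      B ∎
      where
      regroup : ∀ k x e l → k ℤ.* x ℤ.+ (- e) ℤ.* l ≡ k ℤ.* (x ℤ.+ e) ℤ.- e ℤ.* (l ℤ.+ k)
      regroup = solve-∀

    rising-face : Rising.Face F
    rising-face = Rising.face-between (F≢0 (ℕ.m≤m+n L K)) rising-at-L (F≢0 ℕ.≤-refl) on-L+K
      min≤weight on-face⇒between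
      where
      L+K≢L : L + K ≢ L
      L+K≢L L+K≡L = ℕ.>⇒≢ 0<K (ℕ.+-cancelˡ-≡ L K 0 (trans L+K≡L (sym (ℕ.+-identityʳ L))))
      on-L+K : Rising.weight F (L + K) ≡ B
      on-L+K = trans (rising-off ℕ.≤-refl L+K≢L)
        (trans (cong (λ x → B ℤ.+ + (e * x)) (ℕ.n∸n≡0 (L + K)))
          (trans (cong (λ x → B ℤ.+ + x) (ℕ.*-zeroʳ e)) (ℤ.+-identityʳ B)))
      min≤weight : ∀ {i} → F i ≢ 0ℚ → B ℤ.≤ Rising.weight F i
      min≤weight {i} Fi≢0 with i ℕ.≟ L
      ... | yes refl = ℤ.≤-reflexive (sym rising-at-L)
      ... | no i≢L = proj₁ (above-by (L + K ∸ i) (rising-off (F-support Fi≢0) i≢L))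
      on-face⇒between : ∀ {i} → F i ≢ 0ℚ → Rising.weight F i ≡ B → L ≤ i × i ≤ L + K
      on-face⇒between {i} Fi≢0 w≡B with i ℕ.≟ L
      ... | yes refl = ℕ.≤-refl , ℕ.m≤m+n L K
      ... | no i≢L = subst (L ≤_) (sym i≡L+K) (ℕ.m≤m+n L K) , F-support Fi≢0
        where
        i≡L+K : i ≡ L + K
        i≡L+K = ℕ.≤-antisym (F-support Fi≢0)
          (ℕ.m∸n≡0⇒m≤n (proj₂ (above-by (L + K ∸ i) (rising-off (F-support Fi≢0) i≢L)) w≡B))

  falling-ends : ∀ (Φ : Falling.Face F) → Falling.Face.first Φ ≡ 0 × Falling.Face.last Φ ≡ L
  falling-ends Φ = Falling.face-unique Φ falling-face

  rising-ends : ∀ (Ψ : Rising.Face F) → Rising.Face.first Ψ ≡ L × Rising.Face.last Ψ ≡ L + K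
  rising-ends Ψ = Rising.face-unique Ψ rising-face

module CoefficientIdentity where

  open import Data.Nat
  open import Data.Nat.Properties
  open import Data.Nat.Combinatorics using (_C_; nCk≡n!/k![n-k]!; k![n∸k]!∣n!)
  open import Data.Nat.DivMod using (m/n*n≡m)
  open import Data.Nat.Tactic.RingSolver using (solve-∀)
  open import Data.Integer as ℤ using (-1ℤ)
  import Data.Integer.Properties as ℤ
  open import Defs using (c)
  open import Relation.Binary.PropositionalEquality
  open ≡-Reasoning

  nCk*[k!*[n∸k]!]≡n! : ∀ n k → k ≤ n → (n C k) * (k ! * (n ∸ k) !) ≡ n !
  nCk*[k!*[n∸k]!]≡n! n k k≤n = trans (cong (_* (k ! * (n ∸ k) !)) (nCk≡n!/k![n-k]! k≤n))
                                     (m/n*n≡m {{k !* (n ∸ k) !≢0}} (k![n∸k]!∣n! k≤n))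

  coefficient-factorial-identity : ∀ {n k i} → i ≤ k → k < n →
    ((n C i) * ((n ∸ i ∸ 1) C (k ∸ i))) * ((i ! * (k ∸ i) !) * ((n ∸ i) * (n ∸ k ∸ 1) !)) ≡ n !
  coefficient-factorial-identity {n} {k} {i} i≤k k<n = begin
    ((n C i) * (N C (k ∸ i))) * ((i ! * (k ∸ i) !) * ((n ∸ i) * R !))
      ≡⟨ regroup (n C i) (N C (k ∸ i)) (i !) ((k ∸ i) !) (n ∸ i) (R !) ⟩
    (n C i) * (i ! * ((n ∸ i) * ((N C (k ∸ i)) * ((k ∸ i) ! * R !))))
      ≡⟨ cong (λ r → (n C i) * (i ! * ((n ∸ i) * ((N C (k ∸ i)) * ((k ∸ i) ! * r !))))) N∸[k∸i]≡R ⟨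
    (n C i) * (i ! * ((n ∸ i) * ((N C (k ∸ i)) * ((k ∸ i) ! * (N ∸ (k ∸ i)) !))))
      ≡⟨ cong (λ m → (n C i) * (i ! * ((n ∸ i) * m))) (nCk*[k!*[n∸k]!]≡n! N (k ∸ i) k∸i≤N) ⟩
    (n C i) * (i ! * ((n ∸ i) * N !))
      ≡⟨ cong (λ m → (n C i) * (i ! * (m * N !))) n∸i≡1+N ⟩
    (n C i) * (i ! * suc N !)
      ≡⟨ cong (λ m → (n C i) * (i ! * m !)) n∸i≡1+N ⟨
    (n C i) * (i ! * (n ∸ i) !)
      ≡⟨ nCk*[k!*[n∸k]!]≡n! n i (<⇒≤ (≤-<-trans i≤k k<n)) ⟩
    n ! ∎
    where
    N = n ∸ i ∸ 1
    R = n ∸ k ∸ 1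
    n∸i≡1+N : n ∸ i ≡ suc N
    n∸i≡1+N = trans (sym (m∸n+n≡m (m<n⇒0<n∸m (≤-<-trans i≤k k<n)))) (+-comm N 1)
    k∸i≤N : k ∸ i ≤ N
    k∸i≤N = ≤-pred (subst (k ∸ i <_) n∸i≡1+N (∸-monoˡ-< k<n i≤k))
    N∸[k∸i]≡R : N ∸ (k ∸ i) ≡ R
    N∸[k∸i]≡R = begin
      n ∸ i ∸ 1 ∸ (k ∸ i)     ≡⟨ ∸-+-assoc (n ∸ i) 1 (k ∸ i) ⟩
      n ∸ i ∸ (1 + (k ∸ i))   ≡⟨ ∸-+-assoc n i (1 + (k ∸ i)) ⟩
      n ∸ (i + (1 + (k ∸ i))) ≡⟨ cong (n ∸_) (trans (+-suc i (k ∸ i)) (cong suc (m+[n∸m]≡n i≤k))) ⟩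
      n ∸ suc k               ≡⟨ cong (n ∸_) (+-comm 1 k) ⟩
      n ∸ (k + 1)             ≡⟨ ∸-+-assoc n k 1 ⟨
      n ∸ k ∸ 1               ∎
    regroup : ∀ a b c d e f → (a * b) * ((c * d) * (e * f)) ≡ a * (c * (e * (b * (d * f))))
    regroup = solve-∀

  ∣c∣≡ : ∀ n k i → ℤ.∣ c n k i ∣ ≡ (n C i) * ((n ∸ i ∸ 1) C (k ∸ i))
  ∣c∣≡ n k i = trans (∣±1^m*x∣≡∣x∣ (k ∸ i) _) (ℤ.abs-* (ℤ.+ (n C i)) (ℤ.+ ((n ∸ i ∸ 1) C (k ∸ i))))
    where
    ∣±1^m*x∣≡∣x∣ : ∀ m x → ℤ.∣ (-1ℤ ℤ.^ m) ℤ.* x ∣ ≡ ℤ.∣ x ∣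
    ∣±1^m*x∣≡∣x∣ zero    x = cong ℤ.∣_∣ (ℤ.*-identityˡ x)
    ∣±1^m*x∣≡∣x∣ (suc m) x = begin
      ℤ.∣ -1ℤ ℤ.* (-1ℤ ℤ.^ m) ℤ.* x ∣   ≡⟨ cong ℤ.∣_∣ (ℤ.*-assoc -1ℤ (-1ℤ ℤ.^ m) x) ⟩
      ℤ.∣ -1ℤ ℤ.* ((-1ℤ ℤ.^ m) ℤ.* x) ∣ ≡⟨ ℤ.abs-* -1ℤ ((-1ℤ ℤ.^ m) ℤ.* x) ⟩
      1 * ℤ.∣ (-1ℤ ℤ.^ m) ℤ.* x ∣       ≡⟨ *-identityˡ _ ⟩
      ℤ.∣ (-1ℤ ℤ.^ m) ℤ.* x ∣           ≡⟨ ∣±1^m*x∣≡∣x∣ m x ⟩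
      ℤ.∣ x ∣                           ∎

  c≢0 : ∀ {n k i} → i ≤ k → k < n → c n k i ≢ ℤ.0ℤ
  c≢0 {n} {k} {i} i≤k k<n ci≡0 = ≢-nonZero⁻¹ (n !) {{n !≢0}} (begin
    n !                                   ≡⟨ coefficient-factorial-identity i≤k k<n ⟨
    (n C i) * ((n ∸ i ∸ 1) C (k ∸ i)) * X ≡⟨ cong (_* X) (trans (sym (∣c∣≡ n k i)) (cong ℤ.∣_∣ ci≡0)) ⟩
    0                                     ∎)
    where X = (i ! * (k ∸ i) !) * ((n ∸ i) * (n ∸ k ∸ 1) !)

module CoefficientOrder {p : ℕ} (p-prime : Prime p) where

  open import Data.Nat
  open import Data.Nat.Properties
  open import Data.Nat.Combinatorics using (_C_)
  open import Data.Nat.Primality using (euclidsLemma)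
  import Data.Integer as ℤ
  open import Data.Sum using ([_,_]′)
  open import Relation.Binary.PropositionalEquality
  open import Defs using (c)
  open PadicOrder p-prime
  open CoefficientIdentity
  open ≡-Reasoning

  private
    ord∣c∣+ord[n∸i] : ∀ {n k i} → k < p → i ≤ k → k < n →
                      ord ℤ.∣ c n k i ∣ + (ord (n ∸ i) + ord ((n ∸ k ∸ 1) !)) ≡ ord (n !)
    ord∣c∣+ord[n∸i] {n} {k} {i} k<p i≤k k<n = begin
      ord ℤ.∣ c n k i ∣ + (ord (n ∸ i) + ord (R !))
        ≡⟨ cong (λ m → ord m + (ord (n ∸ i) + ord (R !))) (∣c∣≡ n k i) ⟩
      ord cᵢ + (ord (n ∸ i) + ord (R !))
        ≡⟨ cong (λ m → ord cᵢ + (m + (ord (n ∸ i) + ord (R !)))) ord[A]≡0 ⟨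
      ord cᵢ + (ord A + (ord (n ∸ i) + ord (R !)))
        ≡⟨ cong (λ m → ord cᵢ + (ord A + m)) (ord-* (n ∸ i) (R !)) ⟨
      ord cᵢ + (ord A + ord ((n ∸ i) * R !))
        ≡⟨ cong (ord cᵢ +_) (ord-* A ((n ∸ i) * R !)) ⟨
      ord cᵢ + ord (A * ((n ∸ i) * R !))
        ≡⟨ ord-* cᵢ (A * ((n ∸ i) * R !)) ⟨
      ord (cᵢ * (A * ((n ∸ i) * R !)))
        ≡⟨ cong ord (coefficient-factorial-identity i≤k k<n) ⟩
      ord (n !) ∎
      where
      R = n ∸ k ∸ 1
      cᵢ = (n C i) * ((n ∸ i ∸ 1) C (k ∸ i))
      A = i ! * (k ∸ i) !
      instance
        cᵢB≢0 : NonZero (cᵢ * (A * ((n ∸ i) * R !)))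
        cᵢB≢0 = subst NonZero (sym (coefficient-factorial-identity i≤k k<n)) (n !≢0)
        cᵢ≢0 : NonZero cᵢ
        cᵢ≢0 = m*n≢0⇒m≢0 cᵢ
        B≢0 : NonZero (A * ((n ∸ i) * R !))
        B≢0 = m*n≢0⇒n≢0 cᵢ
        A≢0 : NonZero A
        A≢0 = i !* (k ∸ i) !≢0
        [n∸i]R!≢0 : NonZero ((n ∸ i) * R !)
        [n∸i]R!≢0 = m*n≢0⇒n≢0 A
        n∸i≢0 : NonZero (n ∸ i)
        n∸i≢0 = m*n≢0⇒m≢0 (n ∸ i)
        R!≢0 : NonZero (R !)
        R!≢0 = R !≢0
      ord[A]≡0 : ord A ≡ 0
      ord[A]≡0 = p∤n⇒ord≡0 λ p∣A → [ p∤m! (≤-<-trans i≤k k<p) , p∤m! (≤-<-trans (m∸n≤m k i) k<p) ]′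
                                      (euclidsLemma (i !) ((k ∸ i) !) p-prime p∣A)

  ord∣c∣+ord[n∸i]-independent : ∀ {n k i j} → k < p → i ≤ k → j ≤ k → k < n →
    ord ℤ.∣ c n k i ∣ + ord (n ∸ i) ≡ ord ℤ.∣ c n k j ∣ + ord (n ∸ j)
  ord∣c∣+ord[n∸i]-independent {n} {k} {i} {j} k<p i≤k j≤k k<n = +-cancelʳ-≡ (ord ((n ∸ k ∸ 1) !)) _ _ (begin
    ord ℤ.∣ c n k i ∣ + ord (n ∸ i) + ord ((n ∸ k ∸ 1) !)   ≡⟨ +-assoc (ord ℤ.∣ c n k i ∣) _ _ ⟩
    ord ℤ.∣ c n k i ∣ + (ord (n ∸ i) + ord ((n ∸ k ∸ 1) !)) ≡⟨ ord∣c∣+ord[n∸i] k<p i≤k k<n ⟩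
    ord (n !)                                               ≡⟨ ord∣c∣+ord[n∸i] k<p j≤k k<n ⟨
    ord ℤ.∣ c n k j ∣ + (ord (n ∸ j) + ord ((n ∸ k ∸ 1) !)) ≡⟨ +-assoc (ord ℤ.∣ c n k j ∣) _ _ ⟨
    ord ℤ.∣ c n k j ∣ + ord (n ∸ j) + ord ((n ∸ k ∸ 1) !)   ∎)

module HalfMultiples where

  open import Data.Nat
  open import Data.Nat.Properties
  open import Data.Nat.Divisibility
  open import Data.Nat.GCD using (gcd; gcd-greatest; c*gcd[m,n]≡gcd[cm,cn]; gcd[m,n]≢0)
  open import Data.Sum using (_⊎_; inj₁; inj₂)
  open import Relation.Nullary using (contradiction)
  open import Relation.Binary.PropositionalEquality

  HalfMultiple : ℕ → ℕ → Set
  HalfMultiple L s = s ≡ 0 ⊎ 2 * s ≡ L ⊎ s ≡ L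

  L∣2s⇒half-multiple : ∀ {L s} → 0 < L → s ≤ L → L ∣ 2 * s → HalfMultiple L s
  L∣2s⇒half-multiple {L} {s} 0<L s≤L (divides q 2s≡qL) with q
  ... | 0 = inj₁ (m+n≡0⇒m≡0 s 2s≡qL)
  ... | 1 = inj₂ (inj₁ (trans 2s≡qL (+-identityʳ L)))
  ... | 2 = inj₂ (inj₂ (*-cancelˡ-≡ s L 2 2s≡qL))
  ... | suc (suc (suc q)) = contradiction s≤L (<⇒≱ L<s)
    where
    L<s : L < s
    L<s = *-cancelˡ-< 2 L s (begin-strict
      2 * L       <⟨ *-monoˡ-< L {{>-nonZero 0<L}} {2} {3 + q} (s≤s (s≤s (s≤s z≤n))) ⟩
      (3 + q) * L ≡⟨ 2s≡qL ⟨
      2 * s       ∎)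
      where open ≤-Reasoning

  L∣e*s⇒L∣2*s : ∀ {L e s} → 0 < L → gcd e L ≤ 2 → L ∣ e * s → L ∣ 2 * s
  L∣e*s⇒L∣2*s {L} {e} {s} 0<L gcd≤2 L∣es = ∣-trans L∣gcd*s (*-monoˡ-∣ s gcd∣2)
    where
    L∣gcd*s : L ∣ gcd e L * s
    L∣gcd*s = subst (L ∣_) (trans (sym (c*gcd[m,n]≡gcd[cm,cn] s e L)) (*-comm s (gcd e L)))
      (gcd-greatest (subst (L ∣_) (*-comm e s) L∣es) (n∣m*n s))
    gcd∣2 : gcd e L ∣ 2
    gcd∣2 = n≢0∧n≤2⇒n∣2 (gcd[m,n]≢0 e L (inj₂ λ L≡0 → <⇒≢ 0<L (sym L≡0))) gcd≤2
      where
      n≢0∧n≤2⇒n∣2 : ∀ {n} → n ≢ 0 → n ≤ 2 → n ∣ 2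
      n≢0∧n≤2⇒n∣2 {0} n≢0 _ = contradiction refl n≢0
      n≢0∧n≤2⇒n∣2 {1} _   _ = 1∣ 2
      n≢0∧n≤2⇒n∣2 {2} _   _ = ∣-refl
      n≢0∧n≤2⇒n∣2 {suc (suc (suc _))} _ (s≤s (s≤s ()))

  private
    half≤ : ∀ {L u} → 2 * u ≡ L ⊎ u ≡ L → L ≤ 2 * u
    half≤ (inj₁ 2u≡L) = ≤-reflexive (sym 2u≡L)
    half≤ (inj₂ refl) = m≤n*m _ 2

  half-multiples-split : ∀ {k l l₁ s t} → l ≤ k → 1 ≤ l₁ → 2 * l₁ < k → l₁ ≡ s + t →
                         HalfMultiple l s → HalfMultiple (k ∸ l) t →
                         l ≡ l₁ ⊎ l ≡ 2 * l₁ ⊎ l ≡ k ∸ l₁ ⊎ l ≡ k ∸ 2 * l₁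
  half-multiples-split {k} {l} {l₁} {s} {t} l≤k 1≤l₁ 2l₁<k l₁≡s+t = cases
    where
    k∸[k∸l]≡l : k ∸ (k ∸ l) ≡ l
    k∸[k∸l]≡l = m∸[m∸n]≡n l≤k
    2l₁≡2s+2t : 2 * l₁ ≡ 2 * s + 2 * t
    2l₁≡2s+2t = trans (cong (2 *_) l₁≡s+t) (*-distribˡ-+ 2 s t)

    cases : HalfMultiple l s → HalfMultiple (k ∸ l) t → l ≡ l₁ ⊎ l ≡ 2 * l₁ ⊎ l ≡ k ∸ l₁ ⊎ l ≡ k ∸ 2 * l₁
    cases (inj₁ refl) (inj₁ refl) = contradiction (sym l₁≡s+t) (<⇒≢ 1≤l₁)
    cases (inj₁ refl) (inj₂ (inj₁ 2t≡k∸l)) = inj₂ (inj₂ (inj₂ (sym (begin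
      k ∸ 2 * l₁  ≡⟨ cong (k ∸_) (trans 2l₁≡2s+2t 2t≡k∸l) ⟩
      k ∸ (k ∸ l) ≡⟨ k∸[k∸l]≡l ⟩
      l           ∎))))
      where open ≡-Reasoning
    cases (inj₁ refl) (inj₂ (inj₂ t≡k∸l)) = inj₂ (inj₂ (inj₁ (sym (begin
      k ∸ l₁      ≡⟨ cong (k ∸_) (trans l₁≡s+t t≡k∸l) ⟩
      k ∸ (k ∸ l) ≡⟨ k∸[k∸l]≡l ⟩
      l           ∎))))
      where open ≡-Reasoning
    cases (inj₂ (inj₁ 2s≡l)) (inj₁ refl) = inj₂ (inj₁ (sym (trans (trans 2l₁≡2s+2t (+-identityʳ (2 * s))) 2s≡l)))
    cases (inj₂ (inj₂ s≡l)) (inj₁ refl) = inj₁ (sym (trans (trans l₁≡s+t (+-identityʳ s)) s≡l))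
    cases (inj₂ s-half) (inj₂ t-half) = contradiction 2l₁<k (≤⇒≯ (begin
      k               ≡⟨ m+[n∸m]≡n l≤k ⟨
      l + (k ∸ l)     ≤⟨ +-mono-≤ (half≤ s-half) (half≤ t-half) ⟩
      2 * s + 2 * t   ≡⟨ 2l₁≡2s+2t ⟨
      2 * l₁          ∎))
      where open ≤-Reasoning

module CoefficientsOfF {k n : ℕ} (a : Fin (suc k) → ℤ) where

  open import Data.Nat.Properties using (≤-pred; <⇒≱)
  open import Data.Nat using (_<?_; s≤s)
  open import Data.Fin using (fromℕ<)
  open import Data.Product using (∃; _,_)
  open import Data.Rational using (0ℚ)
  open import Relation.Nullary using (yes; no; contradiction)
  open import Relation.Binary.PropositionalEquality using (refl)

  F-vanishes : ∀ {i} → k < i → Fcoeff n k a i ≡ 0ℚ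
  F-vanishes {i} k<i with i <? suc k
  ... | yes i<1+k = contradiction (≤-pred i<1+k) (<⇒≱ k<i)
  ... | no _      = refl

  F-value : ∀ {i} → i ≤ k → ∃ λ j → Fcoeff n k a i ≡ toℚ (a j ℤ.* c n k i)
  F-value {i} i≤k with i <? suc k
  ... | yes i<1+k = fromℕ< i<1+k , refl
  ... | no i≮1+k  = contradiction (s≤s i≤k) i≮1+k

module ValuationsOfF {p : ℕ} (p-prime : Prime p) {k n : ℕ} (k<p : k < p) (k<n : k < n)
  (a : Fin (suc k) → ℤ) (a≢0 : ∀ j → ¬ a j ≡ ℤ.0ℤ) (p∤a : ∀ j → ¬ p ∣ ℤ.∣ a j ∣)
  {l e : ℕ} (1≤l : 1 ≤ l) (l<k : l < k)
  (p∣n∸l : p ∣ n ∸ l) (p^e∣n∸l : p ^ e ∣ n ∸ l) (p^1+e∤n∸l : ¬ p ^ suc e ∣ n ∸ l)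
  where

  open import Data.Nat as ℕ using (z≤n)
  import Data.Nat.Properties as ℕ
  open import Data.Integer using (+_)
  open import Data.Rational using (0ℚ)
  open import Data.Product using (_×_; _,_; proj₁; proj₂)
  open import Relation.Binary.PropositionalEquality
  open Valuation p-prime
  open CoefficientIdentity using (c≢0)
  open CoefficientOrder p-prime
  open CoefficientsOfF {n = n} a

  private
    F = Fcoeff n k a

  v-F : ∀ {i} → i ≤ k → F i ≢ 0ℚ × v (F i) ≡ + ord ℤ.∣ c n k i ∣
  v-F {i} i≤k with F-value i≤k
  ... | j , Fi≡ = subst (_≢ 0ℚ) (sym Fi≡) (proj₁ v[aj*ci]) , (begin
    v (F i)                              ≡⟨ cong v Fi≡ ⟩
    v (toℚ (a j ℤ.* c n k i))            ≡⟨ proj₂ v[aj*ci] ⟩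
    + ordℤ (a j ℤ.* c n k i)             ≡⟨ cong +_ (ordℤ-* (a≢0 j) ci≢0) ⟩
    + (ordℤ (a j) ℕ.+ ordℤ (c n k i))    ≡⟨ cong (λ x → + (x ℕ.+ ordℤ (c n k i))) (p∤n⇒ord≡0 (p∤a j)) ⟩
    + ord ℤ.∣ c n k i ∣                  ∎)
    where
    open ≡-Reasoning
    ci≢0 = c≢0 i≤k k<n
    v[aj*ci] = v-toℚ (a j ℤ.* c n k i) (i≢0∧j≢0⇒i*j≢0 (a≢0 j) ci≢0)

  ord[n∸i]≡0 : ∀ {i} → i ≤ k → i ≢ l → ord (n ∸ i) ≡ 0
  ord[n∸i]≡0 i≤k i≢l = p∤n⇒ord≡0 (p∣n∸l⇒p∤n∸i (ℕ.<⇒≤ (ℕ.≤-<-trans i≤k k<n))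
    (ℕ.<⇒≤ (ℕ.<-trans l<k k<n)) i≢l (ℕ.≤-<-trans i≤k k<p) (ℕ.<-trans l<k k<p) p∣n∸l)

  ord[n∸l]≡e : ord (n ∸ l) ≡ e
  ord[n∸l]≡e = ord-exact (n ∸ l) {{ℕ.>-nonZero (ℕ.m<n⇒0<n∸m (ℕ.<-trans l<k k<n))}} p^e∣n∸l p^1+e∤n∸l

  0≢l : 0 ≢ l
  0≢l = ℕ.<⇒≢ 1≤l

  V : ℤ
  V = + ord ℤ.∣ c n k 0 ∣

  v-off : ∀ {i} → i ≤ k → i ≢ l → v (F i) ≡ V
  v-off {i} i≤k i≢l = trans (proj₂ (v-F i≤k)) (cong +_ (ℕ.+-cancelʳ-≡ 0 _ _ (begin
    ord ℤ.∣ c n k i ∣ ℕ.+ 0            ≡⟨ cong (ord ℤ.∣ c n k i ∣ ℕ.+_) (ord[n∸i]≡0 i≤k i≢l) ⟨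
    ord ℤ.∣ c n k i ∣ ℕ.+ ord (n ∸ i)  ≡⟨ ord∣c∣+ord[n∸i]-independent k<p i≤k z≤n k<n ⟩
    ord ℤ.∣ c n k 0 ∣ ℕ.+ ord n        ≡⟨ cong (ord ℤ.∣ c n k 0 ∣ ℕ.+_) (ord[n∸i]≡0 z≤n 0≢l) ⟩
    ord ℤ.∣ c n k 0 ∣ ℕ.+ 0            ∎)))
    where open ≡-Reasoning

  v-at-l : v (F l) ℤ.+ + e ≡ V
  v-at-l = begin
    v (F l) ℤ.+ + e
      ≡⟨ cong (ℤ._+ + e) (proj₂ (v-F l≤k)) ⟩
    + (ord ℤ.∣ c n k l ∣ ℕ.+ e)
      ≡⟨ cong (λ x → + (ord ℤ.∣ c n k l ∣ ℕ.+ x)) ord[n∸l]≡e ⟨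
    + (ord ℤ.∣ c n k l ∣ ℕ.+ ord (n ∸ l))
      ≡⟨ cong +_ (ord∣c∣+ord[n∸i]-independent k<p l≤k z≤n k<n) ⟩
    + (ord ℤ.∣ c n k 0 ∣ ℕ.+ ord n)
      ≡⟨ cong (λ x → + (ord ℤ.∣ c n k 0 ∣ ℕ.+ x)) (ord[n∸i]≡0 z≤n 0≢l) ⟩
    + (ord ℤ.∣ c n k 0 ∣ ℕ.+ 0)
      ≡⟨ cong +_ (ℕ.+-identityʳ _) ⟩
    V ∎
    where
    open ≡-Reasoning
    l≤k = ℕ.<⇒≤ l<k

  0<e : 0 < e
  0<e = ℕ.n≢0⇒n>0 λ e≡0 → p^1+e∤n∸l (subst (λ x → p ^ suc x ∣ n ∸ l) (sym e≡0)
                                        (subst (_∣ n ∸ l) (sym (ℕ.*-identityʳ p)) p∣n∸l))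

  K : ℕ
  K = k ∸ l

  0<K : 0 < K
  0<K = ℕ.m<n⇒0<n∸m l<k

  l+K≡k : l ℕ.+ K ≡ k
  l+K≡k = ℕ.m+[n∸m]≡n (ℕ.<⇒≤ l<k)

  private
    F-vanishes-above : ∀ {i} → l ℕ.+ K < i → F i ≡ 0ℚ
    F-vanishes-above {i} l+K<i = F-vanishes (subst (_< i) l+K≡k l+K<i)

    F≢0 : ∀ {i} → i ≤ l ℕ.+ K → F i ≢ 0ℚ
    F≢0 {i} i≤l+K = proj₁ (v-F (subst (i ≤_) l+K≡k i≤l+K))

    v-off-segment : ∀ {i} → i ≤ l ℕ.+ K → i ≢ l → v (F i) ≡ V
    v-off-segment {i} i≤l+K = v-off (subst (i ≤_) l+K≡k i≤l+K)

    module Polygon = TwoSegmentPolygon p-prime 1≤l 0<K 0<e V F-vanishes-above F≢0 v-off-segment v-at-l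
    open FactorSegments p-prime l K e 0<K 0<e
    open Polynomials

  factor-split : ∀ {d} → HasFactorOfDegree d F → SegmentSplit d
  factor-split {d} (g , g[d]≢0 , m , h , F≡g*h) =
    factor-segments F≡g*h Polygon.falling-ends Polygon.rising-ends F-vanishes-above
      (subst (_≢ 0ℚ) (sym (vcoeff-last g)) g[d]≢0 , vcoeff-vanishes g)
      m (vcoeff-vanishes h) (F≢0 z≤n)

theorem1p3 : (k n : ℕ) → 2 ≤ k → k + 2 ≤ n →
    (a : Fin (suc k) → ℤ) →
    (∀ j → ¬ a j ≡ ℤ.0ℤ) →
    (∀ j p → Prime p → p ∣ ℤ.∣ a j ∣ → p ≤ k) →
    (p l e : ℕ) → Prime p → k < p → 1 ≤ l → l ≤ k ∸ 1 →
    p ∣ (n ∸ l) →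
    p ^ e ∣ (n ∸ l) → ¬ (p ^ (suc e) ∣ (n ∸ l)) →
    gcd e l ≤ 2 → gcd e (k ∸ l) ≤ 2 →
    (l₁ : ℕ) → 1 ≤ l₁ → 2 * l₁ < k →
    ¬ l ≡ l₁ → ¬ l ≡ 2 * l₁ → ¬ l ≡ k ∸ l₁ → ¬ l ≡ k ∸ 2 * l₁ →
    ¬ HasFactorOfDegree l₁ (Fcoeff n k a)
theorem1p3 k n 2≤k k+2≤n a a≢0 a-smooth p l e p-prime k<p 1≤l l≤k∸1 p∣n∸l p^e∣n∸l p^1+e∤n∸l
           gcd[e,l]≤2 gcd[e,K]≤2 l₁ 1≤l₁ 2l₁<k l≢l₁ l≢2l₁ l≢k∸l₁ l≢k∸2l₁ factor =
  [ l≢l₁ , [ l≢2l₁ , [ l≢k∸l₁ , l≢k∸2l₁ ]′ ]′ ]′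
    (half-multiples-split (<⇒≤ l<k) 1≤l₁ 2l₁<k d≡s+t
      (L∣2s⇒half-multiple 1≤l s≤L (L∣e*s⇒L∣2*s {e = e} {s} 1≤l gcd[e,l]≤2 L∣e*s))
      (L∣2s⇒half-multiple 0<K t≤K (L∣e*s⇒L∣2*s {e = e} {t} 0<K gcd[e,K]≤2 K∣e*t)))
  where
  open import Data.Nat using (s≤s; z≤n)
  open import Data.Nat.Properties using (≤-trans; <-≤-trans; <⇒≱; <⇒≤; m<m+n; m∸n+n≡m; +-comm)
  open import Data.Sum using ([_,_]′)
  open import Relation.Binary.PropositionalEquality using (subst; trans)
  open HalfMultiples
  k<n : k < n
  k<n = <-≤-trans (m<m+n k (s≤s z≤n)) k+2≤n
  l<k : l < k
  l<k = subst (suc l ≤_) (trans (+-comm 1 (k ∸ 1)) (m∸n+n≡m (≤-trans (s≤s z≤n) 2≤k))) (s≤s l≤k∸1)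
  p∤a : ∀ j → ¬ p ∣ ℤ.∣ a j ∣
  p∤a j p∣aj = <⇒≱ k<p (a-smooth j p p-prime p∣aj)
  open ValuationsOfF p-prime k<p k<n a a≢0 p∤a {e = e} 1≤l l<k p∣n∸l p^e∣n∸l p^1+e∤n∸l
  open FactorSegments.SegmentSplit (factor-split factor)
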